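{- Let $1\le k_1<k_2<\cdots<k_s$ be fixed integers and let $P_{k_1,\dots,k_s}(x)$ be the characteristic polynomial of the minimal homogeneous linear recurrence with integer coefficients satisfied by the sequence $\{S_n\}_{n\in\mathbb{N}}$, where $$S_n=S(\sigma_{n,k_1}+\cdots+\sigma_{n,k_s})=\sum_{j=0}^n(-1)^{\binom{j}{k_1}+\cdots+\binom{j}{k_s}}\binom{n}{j}.$$ Let $\bar{k}=2\lfloor (k_1\vee\cdots\vee k_s)/2\rfloor+1$, with binary expansion $\bar k=1+2^{a_1}+\cdots+2^{a_l}$, $1\le a_1<\cdots<a_l=\lfloor\log_2(\bar k)\rfloor$. Then $P_{k_1,\dots,k_s}(x)$ divides $$(x-2)\prod_{j=1}^l\Phi_{2^{a_j+1}}(x-1).$$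
   Context: $\mathbb{N}=\{1,2,3,\dots\}$. For natural numbers $m,n$, $m\vee n$ is the natural number obtained by applying the bitwise OR coordinatewise to the binary digits of $m$ and $n$ (e.g. $3\vee 8=11$). $\Phi_m$ is the $m$-th cyclotomic polynomial. The sum $S_n$ is the exponential sum $\sum_{x\in\mathbb{F}_2^n}(-1)^{F(x)}$ of the symmetric Boolean function $F=\sigma_{n,k_1}+\cdots+\sigma_{n,k_s}$ ($\sigma_{n,k}$ the elementary symmetric polynomial of degree $k$ in $n$ variables), defined for all $n$ by the displayed binomial sum. A homogeneous linear recurrence $x_n=\sum_{i=1}^D a_ix_{n-i}$ with $a_i\in\mathbb{Z}$ has characteristic polynomial $x^D-\sum_{i=1}^D a_ix^{D-i}$; "minimal" means of least order. -}

module Defs where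

open import Data.Bool using (Bool; true; false; if_then_else_; _∨_)
open import Data.Nat as ℕ using (ℕ; zero; suc; _∸_; _/_; _%_; _≡ᵇ_)
open import Data.Nat.Combinatorics using (_C_)
open import Data.Integer as ℤ using (ℤ; +_; -_)
open import Data.Fin using (Fin; toℕ; zero; suc)
open import Data.List using (List; []; _∷_; foldr; reverse; map)
open import Data.List.Relation.Unary.Linked using (Linked)
open import Data.Product using (Σ; _×_)
open import Relation.Binary.PropositionalEquality using (_≡_)
import Data.Vec.Functional as VF

neg1^ : ℕ → ℤ
neg1^ zero    = + 1
neg1^ (suc e) = - neg1^ e

sumFin : ∀ {D} → (Fin D → ℤ) → ℤ
sumFin {zero}  f = + 0
sumFin {suc D} f = f zero ℤ.+ sumFin (λ i → f (suc i))

sumTo : ℕ → (ℕ → ℤ) → ℤ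
sumTo zero    f = f 0
sumTo (suc n) f = sumTo n f ℤ.+ f (suc n)

-- Bitwise OR on ℕ (via fuel; fuel m + n suffices)

odd? : ℕ → Bool
odd? m = (m % 2) ≡ᵇ 1

borF : ℕ → ℕ → ℕ → ℕ
borF zero    m n = 0
borF (suc f) m n =
  (if odd? m ∨ odd? n then 1 else 0) ℕ.+ 2 ℕ.* borF f (m / 2) (n / 2)

_∨ᵇ_ : ℕ → ℕ → ℕ
m ∨ᵇ n = borF (m ℕ.+ n) m n

bigOr : List ℕ → ℕ
bigOr = foldr _∨ᵇ_ 0

kbar : List ℕ → ℕ
kbar ks = 2 ℕ.* (bigOr ks / 2) ℕ.+ 1

bitSet : ℕ → ℕ → Bool
bitSet m zero    = odd? m
bitSet m (suc b) = bitSet (m / 2) b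

S : List ℕ → ℕ → ℤ
S ks n = sumTo n (λ j → neg1^ (foldr (λ k acc → (j C k) ℕ.+ acc) 0 ks) ℤ.* + (n C j))

-- a : Fin D → ℤ with  a i = a_{i+1};  the recurrence
--   x_n = Σ_{i=1}^D a_i x_{n-i}
-- holds for the sequence x indexed by ℕ = {1,2,3,...}, i.e. for all n with n - D ≥ 1.
Satisfies : (ℕ → ℤ) → (D : ℕ) → (Fin D → ℤ) → Set
Satisfies x D a = ∀ n → suc D ℕ.≤ n →
  x n ≡ sumFin (λ i → a i ℤ.* x (n ∸ suc (toℕ i)))

IsMinimalRecurrence : (ℕ → ℤ) → (D : ℕ) → (Fin D → ℤ) → Set
IsMinimalRecurrence x D a =
  Satisfies x D a × (∀ D' (a' : Fin D' → ℤ) → Satisfies x D' a' → D ℕ.≤ D')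

-- Polynomials over ℤ as coefficient lists, lowest degree first

Poly : Set
Poly = List ℤ

coeff : Poly → ℕ → ℤ
coeff []       n       = + 0
coeff (c ∷ p)  zero    = c
coeff (c ∷ p)  (suc n) = coeff p n

-- equality of polynomials (coefficientwise; trailing zeros irrelevant)
_≈ₚ_ : Poly → Poly → Set
p ≈ₚ q = ∀ n → coeff p n ≡ coeff q n

_+ₚ_ : Poly → Poly → Poly
[]      +ₚ q       = q
(c ∷ p) +ₚ []      = c ∷ p
(c ∷ p) +ₚ (d ∷ q) = (c ℤ.+ d) ∷ (p +ₚ q)

scaleₚ : ℤ → Poly → Poly
scaleₚ c = map (c ℤ.*_)

_*ₚ_ : Poly → Poly → Poly
[]      *ₚ q = []
(c ∷ p) *ₚ q = scaleₚ c q +ₚ (+ 0 ∷ (p *ₚ q))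

composeₚ : Poly → Poly → Poly
composeₚ []      q = []
composeₚ (c ∷ p) q = (c ∷ []) +ₚ (q *ₚ composeₚ p q)

_∣ₚ_ : Poly → Poly → Set
p ∣ₚ r = Σ Poly (λ q → (p *ₚ q) ≈ₚ r)

X : Poly
X = + 0 ∷ + 1 ∷ []

X-_ : ℤ → Poly
X- c = - c ∷ + 1 ∷ []

Xpow : ℕ → Poly
Xpow zero    = + 1 ∷ []
Xpow (suc m) = + 0 ∷ Xpow m

-- Characteristic polynomial x^D - Σ_{i=1}^D a_i x^{D-i}
-- (high-to-low coefficients 1, -a₁, …, -a_D, reversed)
charPoly : (D : ℕ) → (Fin D → ℤ) → Poly
charPoly D a = reverse (+ 1 ∷ VF.toList (λ i → - a i))

-- Cyclotomic polynomial Φ_{2^{a+1}}(x) = x^{2^a} + 1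
Φ2^suc : ℕ → Poly
Φ2^suc a = Xpow (2 ℕ.^ a) +ₚ (+ 1 ∷ [])

bitProd : ℕ → ℕ → Poly
bitProd m zero    = + 1 ∷ []
bitProd m (suc f) =
  (if bitSet m (suc f) then composeₚ (Φ2^suc (suc f)) (X- (+ 1)) else (+ 1 ∷ []))
    *ₚ bitProd m f

-- (x-2) ∏_{j=1}^l Φ_{2^{a_j+1}}(x-1), where k̄ = 1 + 2^{a₁} + ⋯ + 2^{a_l}, 1 ≤ a₁ < ⋯ < a_l
-- (all set bits of k̄ lie at positions < k̄, so ranging b over 1..k̄ covers them)
targetPoly : List ℕ → Poly
targetPoly ks = (X- (+ 2)) *ₚ bitProd (kbar ks) (kbar ks)

-- Write S = B f, where B f (n) = Σⱼ C(n, j) f(j) is the binomial transform of the sign sequence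
-- f(j) = (−1)^(Σᵢ C(j, kᵢ)). By Pascal's rule a polynomial A(x), acting on sequences through the shift,
-- satisfies A(x) (B f) = B (A(x + 1) f). Hence (x − 2) ∏ Φ_{2^(aⱼ+1)}(x − 1) kills S from n = 1 on as soon as
-- (x − 1) ∏ Φ_{2^(aⱼ+1)}(x) turns f into an alternating sequence, i.e. as soon as (x² − 1) ∏ Φ_{2^(aⱼ+1)}(x)
-- kills f. By Lucas's theorem f(j) only depends on the bits of j set in k̄, and the factor
-- Φ_{2^(a+1)}(x) = x^(2^a) + 1 removes the dependence on bit a, leaving a sequence of period 2.
-- Finally, if S satisfies a monic integer recurrence of least order D, Gauss's lemma shows that no nonzero
-- integer polynomial of degree below D kills S, so pseudo-division by the characteristic polynomial
-- leaves no remainder on any polynomial that kills S.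
module Submission where

open import Defs
open import Data.Bool using (Bool; true; false; not; _∨_; _∧_; _xor_; if_then_else_)
import Data.Bool.Properties as BoolP
open import Data.Nat as ℕ using (ℕ; zero; suc; z≤n; s≤s; _≤_; _<_; NonZero; ⌊_/2⌋; _/_)
import Data.Nat.Properties as ℕP
import Data.Nat.Divisibility as ℕD
open import Data.Nat.DivMod using (m/n≡1+[m∸n]/n)
open import Data.Nat.Combinatorics using (_C_; nCk+nC[k+1]≡[n+1]C[k+1]; k>n⇒nCk≡0)
open import Data.Nat.Induction using (<-wellFounded)
open import Data.Nat.Primality using (Prime; euclidsLemma; prime⇒nonZero; prime⇒nonTrivial)
open import Data.Nat.Primality.Factorisation using (factorise)
import Data.Nat.ListAction as ℕL
open import Data.Integer as ℤ using (ℤ; +_; -_; -[1+_]; _+_; _*_; _-_; _^_; -1ℤ)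
import Data.Integer.Properties as ℤP
open import Data.Integer.Divisibility.Signed
  using (_∣_; divides; ∣ᵤ⇒∣; ∣⇒∣ᵤ; ∣m⇒∣m*n; ∣m+n∣m⇒∣n)
open import Data.Integer.Tactic.RingSolver using (solve-∀)
open import Data.Fin using (Fin; toℕ)
import Data.Fin as Fin
import Data.Fin.Properties as FinP
open import Data.List using (List; []; _∷_; _++_; [_]; reverse; length; tabulate; lookup; foldr)
import Data.List.Properties as ListP
open import Data.List.Membership.Propositional using (_∈_)
open import Data.List.Relation.Unary.All using (_∷_)
open import Data.List.Relation.Unary.Any using (here; there)
open import Data.List.Relation.Unary.Linked using (Linked)
import Data.Vec.Functional as VF
open import Data.Product using (Σ; ∃; _,_; _×_; proj₁; proj₂)
open import Data.Sum using (_⊎_; inj₁; inj₂)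
import Data.Sum as Sum
open import Data.Empty using (⊥; ⊥-elim)
open import Function using (_∘_; _∘′_)
open import Induction.WellFounded using (Acc; acc)
open import Relation.Nullary using (yes; no)
open import Relation.Binary.PropositionalEquality
  using (_≡_; _≢_; refl; sym; trans; cong; cong₂; subst; module ≡-Reasoning)

DegreeBelow : ℕ → Poly → Set
DegreeBelow n A = ∀ i → n ≤ i → coeff A i ≡ + 0

coeff-+ₚ : ∀ p q n → coeff (p +ₚ q) n ≡ coeff p n + coeff q n
coeff-+ₚ []      q       n       = sym (ℤP.+-identityˡ _)
coeff-+ₚ (c ∷ p) []      n       = sym (ℤP.+-identityʳ _)
coeff-+ₚ (c ∷ p) (d ∷ q) zero    = refl
coeff-+ₚ (c ∷ p) (d ∷ q) (suc n) = coeff-+ₚ p q n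

coeff-scaleₚ : ∀ c p n → coeff (scaleₚ c p) n ≡ c * coeff p n
coeff-scaleₚ c []      n       = sym (ℤP.*-zeroʳ c)
coeff-scaleₚ c (d ∷ p) zero    = refl
coeff-scaleₚ c (d ∷ p) (suc n) = coeff-scaleₚ c p n

coeff-∷*ₚ-zero : ∀ r R Q → coeff ((r ∷ R) *ₚ Q) 0 ≡ r * coeff Q 0
coeff-∷*ₚ-zero r R Q =
  trans (coeff-+ₚ (scaleₚ r Q) (+ 0 ∷ (R *ₚ Q)) 0) (trans (ℤP.+-identityʳ _) (coeff-scaleₚ r Q 0))

coeff-∷*ₚ-suc : ∀ r R Q j → coeff ((r ∷ R) *ₚ Q) (suc j) ≡ r * coeff Q (suc j) + coeff (R *ₚ Q) j
coeff-∷*ₚ-suc r R Q j =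
  trans (coeff-+ₚ (scaleₚ r Q) (+ 0 ∷ (R *ₚ Q)) (suc j)) (cong (_+ coeff (R *ₚ Q) j) (coeff-scaleₚ r Q (suc j)))

*ₚ-zeroˡ : ∀ R Q → R ≈ₚ [] → (R *ₚ Q) ≈ₚ []
*ₚ-zeroˡ []      Q R≈0 i       = refl
*ₚ-zeroˡ (r ∷ R) Q R≈0 zero    rewrite coeff-∷*ₚ-zero r R Q | R≈0 0 = ℤP.*-zeroˡ (coeff Q 0)
*ₚ-zeroˡ (r ∷ R) Q R≈0 (suc i)
  rewrite coeff-∷*ₚ-suc r R Q i | R≈0 0 | *ₚ-zeroˡ R Q (R≈0 ∘ suc) i
  = trans (ℤP.+-identityʳ _) (ℤP.*-zeroˡ (coeff Q (suc i)))

*ₚ-zeroʳ : ∀ R → (R *ₚ []) ≈ₚ []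
*ₚ-zeroʳ []      i       = refl
*ₚ-zeroʳ (r ∷ R) zero    = trans (coeff-∷*ₚ-zero r R []) (ℤP.*-zeroʳ r)
*ₚ-zeroʳ (r ∷ R) (suc i) = trans (coeff-∷*ₚ-suc r R [] i) (cong₂ _+_ (ℤP.*-zeroʳ r) (*ₚ-zeroʳ R i))

*ₚ-congʳ : ∀ R {Q Q'} → Q ≈ₚ Q' → (R *ₚ Q) ≈ₚ (R *ₚ Q')
*ₚ-congʳ []      Q≈Q' i = refl
*ₚ-congʳ (r ∷ R) {Q} {Q'} Q≈Q' zero
  rewrite coeff-∷*ₚ-zero r R Q | coeff-∷*ₚ-zero r R Q' | Q≈Q' 0 = refl
*ₚ-congʳ (r ∷ R) {Q} {Q'} Q≈Q' (suc i)
  rewrite coeff-∷*ₚ-suc r R Q i | coeff-∷*ₚ-suc r R Q' i | Q≈Q' (suc i) | *ₚ-congʳ R {Q} {Q'} Q≈Q' i = refl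

*ₚ-shiftʳ : ∀ R M → (R *ₚ (+ 0 ∷ M)) ≈ₚ (+ 0 ∷ (R *ₚ M))
*ₚ-shiftʳ []      M zero          = refl
*ₚ-shiftʳ []      M (suc i)       = refl
*ₚ-shiftʳ (r ∷ R) M zero          rewrite coeff-∷*ₚ-zero r R (+ 0 ∷ M) = ℤP.*-zeroʳ r
*ₚ-shiftʳ (r ∷ R) M (suc zero)
  rewrite coeff-∷*ₚ-suc r R (+ 0 ∷ M) 0 | *ₚ-shiftʳ R M 0 | coeff-∷*ₚ-zero r R M = ℤP.+-identityʳ _
*ₚ-shiftʳ (r ∷ R) M (suc (suc i))
  rewrite coeff-∷*ₚ-suc r R (+ 0 ∷ M) (suc i) | *ₚ-shiftʳ R M (suc i) | coeff-∷*ₚ-suc r R M i = refl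

coeff-*ₚ-const : ∀ R t i → coeff (R *ₚ [ t ]) i ≡ coeff R i * t
coeff-*ₚ-const []      t i = sym (ℤP.*-zeroˡ t)
coeff-*ₚ-const (r ∷ R) t zero    rewrite coeff-∷*ₚ-zero r R [ t ] = refl
coeff-*ₚ-const (r ∷ R) t (suc i)
  rewrite coeff-∷*ₚ-suc r R [ t ] i | coeff-*ₚ-const R t i | ℤP.*-zeroʳ r = ℤP.+-identityˡ _

coeff-*ₚ-distribˡ : ∀ R Q Q' i → coeff (R *ₚ (Q +ₚ Q')) i ≡ coeff (R *ₚ Q) i + coeff (R *ₚ Q') i
coeff-*ₚ-distribˡ []      Q Q' i = refl
coeff-*ₚ-distribˡ (r ∷ R) Q Q' zero
  rewrite coeff-∷*ₚ-zero r R (Q +ₚ Q') | coeff-∷*ₚ-zero r R Q | coeff-∷*ₚ-zero r R Q' | coeff-+ₚ Q Q' 0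
  = ℤP.*-distribˡ-+ r _ _
coeff-*ₚ-distribˡ (r ∷ R) Q Q' (suc i)
  rewrite coeff-∷*ₚ-suc r R (Q +ₚ Q') i | coeff-∷*ₚ-suc r R Q i | coeff-∷*ₚ-suc r R Q' i
        | coeff-+ₚ Q Q' (suc i) | coeff-*ₚ-distribˡ R Q Q' i
  = regroup r (coeff Q (suc i)) (coeff Q' (suc i)) (coeff (R *ₚ Q) i) (coeff (R *ₚ Q') i)
  where regroup : ∀ r a b u v → r * (a + b) + (u + v) ≡ r * a + u + (r * b + v)
        regroup = solve-∀

coeff-*ₚ-scaleₚʳ : ∀ R c Q i → coeff (R *ₚ scaleₚ c Q) i ≡ c * coeff (R *ₚ Q) i
coeff-*ₚ-scaleₚʳ []      c Q i = sym (ℤP.*-zeroʳ c)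
coeff-*ₚ-scaleₚʳ (r ∷ R) c Q zero
  rewrite coeff-∷*ₚ-zero r R (scaleₚ c Q) | coeff-∷*ₚ-zero r R Q | coeff-scaleₚ c Q 0
  = swap r c (coeff Q 0)
  where swap : ∀ r c a → r * (c * a) ≡ c * (r * a)
        swap = solve-∀
coeff-*ₚ-scaleₚʳ (r ∷ R) c Q (suc i)
  rewrite coeff-∷*ₚ-suc r R (scaleₚ c Q) i | coeff-∷*ₚ-suc r R Q i
        | coeff-scaleₚ c Q (suc i) | coeff-*ₚ-scaleₚʳ R c Q i
  = pull r c (coeff Q (suc i)) (coeff (R *ₚ Q) i)
  where pull : ∀ r c a u → r * (c * a) + c * u ≡ c * (r * a + u)
        pull = solve-∀

coeff-*ₚ-∷ʳ : ∀ R q Q i → coeff (R *ₚ (q ∷ Q)) i ≡ q * coeff R i + coeff (+ 0 ∷ (R *ₚ Q)) i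
coeff-*ₚ-∷ʳ R q Q i = begin
  coeff (R *ₚ (q ∷ Q)) i
    ≡⟨ *ₚ-congʳ R split i ⟩
  coeff (R *ₚ ([ q ] +ₚ (+ 0 ∷ Q))) i
    ≡⟨ coeff-*ₚ-distribˡ R [ q ] (+ 0 ∷ Q) i ⟩
  coeff (R *ₚ [ q ]) i + coeff (R *ₚ (+ 0 ∷ Q)) i
    ≡⟨ cong₂ _+_ (trans (coeff-*ₚ-const R q i) (ℤP.*-comm _ q)) (*ₚ-shiftʳ R Q i) ⟩
  q * coeff R i + coeff (+ 0 ∷ (R *ₚ Q)) i
    ∎
  where
  open ≡-Reasoning
  split : (q ∷ Q) ≈ₚ ([ q ] +ₚ (+ 0 ∷ Q))
  split zero    = sym (ℤP.+-identityʳ q)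
  split (suc i) = refl

coeff-*ₚ-leading : ∀ R Q d e → DegreeBelow (suc d) R → DegreeBelow (suc e) Q →
                   coeff (R *ₚ Q) (d ℕ.+ e) ≡ coeff R d * coeff Q e
coeff-*ₚ-leading []      Q d       e       _    _    = refl
coeff-*ₚ-leading (r ∷ R) Q zero    zero    _    _    = coeff-∷*ₚ-zero r R Q
coeff-*ₚ-leading (r ∷ R) Q zero    (suc e) degR _
  rewrite coeff-∷*ₚ-suc r R Q e | *ₚ-zeroˡ R Q (λ j → degR (suc j) (s≤s z≤n)) e = ℤP.+-identityʳ _
coeff-*ₚ-leading (r ∷ R) Q (suc d) e       degR degQ
  rewrite coeff-∷*ₚ-suc r R Q (d ℕ.+ e) | degQ (suc (d ℕ.+ e)) (s≤s (ℕP.m≤n+m e d)) | ℤP.*-zeroʳ r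
  = trans (ℤP.+-identityˡ _) (coeff-*ₚ-leading R Q d e (λ j le → degR (suc j) (s≤s le)) degQ)

-- (p ⊙ x) n = Σᵢ pᵢ x(n + i): a polynomial acts on sequences as a polynomial in the shift.
infixr 9 _⊙_
_⊙_ : Poly → (ℕ → ℤ) → ℕ → ℤ
([]      ⊙ x) n = + 0
((c ∷ p) ⊙ x) n = c * x n + (p ⊙ x) (suc n)

⊙-+ₚ : ∀ p q x n → ((p +ₚ q) ⊙ x) n ≡ (p ⊙ x) n + (q ⊙ x) n
⊙-+ₚ []      q       x n = sym (ℤP.+-identityˡ _)
⊙-+ₚ (c ∷ p) []      x n = sym (ℤP.+-identityʳ _)
⊙-+ₚ (c ∷ p) (d ∷ q) x n rewrite ⊙-+ₚ p q x (suc n) =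
  regroup c d (x n) ((p ⊙ x) (suc n)) ((q ⊙ x) (suc n))
  where regroup : ∀ c d a u v → (c + d) * a + (u + v) ≡ c * a + u + (d * a + v)
        regroup = solve-∀

⊙-scaleₚ : ∀ c p x n → (scaleₚ c p ⊙ x) n ≡ c * (p ⊙ x) n
⊙-scaleₚ c []      x n = sym (ℤP.*-zeroʳ c)
⊙-scaleₚ c (d ∷ p) x n rewrite ⊙-scaleₚ c p x (suc n) = pull c d (x n) ((p ⊙ x) (suc n))
  where pull : ∀ c d a u → c * d * a + c * u ≡ c * (d * a + u)
        pull = solve-∀

⊙-*ₚ : ∀ p q x n → ((p *ₚ q) ⊙ x) n ≡ (p ⊙ q ⊙ x) n
⊙-*ₚ []      q x n = refl
⊙-*ₚ (c ∷ p) q x n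
  rewrite ⊙-+ₚ (scaleₚ c q) (+ 0 ∷ (p *ₚ q)) x n | ⊙-scaleₚ c q x n | ⊙-*ₚ p q x (suc n)
  = cong (_+_ (c * (q ⊙ x) n)) (ℤP.+-identityˡ _)

⊙-congʳ : ∀ p {x y} → (∀ n → x n ≡ y n) → ∀ n → (p ⊙ x) n ≡ (p ⊙ y) n
⊙-congʳ []      x≡y n = refl
⊙-congʳ (c ∷ p) x≡y n = cong₂ (λ a b → c * a + b) (x≡y n) (⊙-congʳ p x≡y (suc n))

⊙-null : ∀ p x n → p ≈ₚ [] → (p ⊙ x) n ≡ + 0
⊙-null []      x n p≈0 = refl
⊙-null (c ∷ p) x n p≈0 rewrite p≈0 0 | ⊙-null p x (suc n) (λ i → p≈0 (suc i)) = refl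

⊙-congˡ : ∀ p q → p ≈ₚ q → ∀ x n → (p ⊙ x) n ≡ (q ⊙ x) n
⊙-congˡ []      q       p≈q x n = sym (⊙-null q x n (λ i → sym (p≈q i)))
⊙-congˡ (c ∷ p) []      p≈q x n = ⊙-null (c ∷ p) x n p≈q
⊙-congˡ (c ∷ p) (d ∷ q) p≈q x n rewrite p≈q 0 | ⊙-congˡ p q (λ i → p≈q (suc i)) x (suc n) = refl

⊙-linear : ∀ p c x y n → (p ⊙ (λ i → c * x i + y i)) n ≡ c * (p ⊙ x) n + (p ⊙ y) n
⊙-linear []      c x y n = sym (trans (ℤP.+-identityʳ _) (ℤP.*-zeroʳ c))
⊙-linear (d ∷ p) c x y n rewrite ⊙-linear p c x y (suc n) =
  regroup d c (x n) (y n) ((p ⊙ x) (suc n)) ((p ⊙ y) (suc n))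
  where regroup : ∀ d c a b u v → d * (c * a + b) + (c * u + v) ≡ c * (d * a + u) + (d * b + v)
        regroup = solve-∀

⊙-shift : ∀ p x n → (p ⊙ (λ i → x (suc i))) n ≡ (p ⊙ x) (suc n)
⊙-shift []      x n = refl
⊙-shift (c ∷ p) x n = cong (_+_ (c * x (suc n))) (⊙-shift p x (suc n))

⊙-zeroʳ : ∀ p n → (p ⊙ (λ _ → + 0)) n ≡ + 0
⊙-zeroʳ []      n = refl
⊙-zeroʳ (c ∷ p) n rewrite ⊙-zeroʳ p (suc n) | ℤP.*-zeroʳ c = refl

⊙-comm : ∀ p q x n → (p ⊙ q ⊙ x) n ≡ (q ⊙ p ⊙ x) n
⊙-comm []      q x n = sym (⊙-zeroʳ q n)
⊙-comm (c ∷ p) q x n = begin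
  c * (q ⊙ x) n + (p ⊙ q ⊙ x) (suc n)
    ≡⟨ cong (_+_ (c * (q ⊙ x) n)) (⊙-comm p q x (suc n)) ⟩
  c * (q ⊙ x) n + (q ⊙ p ⊙ x) (suc n)
    ≡⟨ cong (_+_ (c * (q ⊙ x) n)) (sym (⊙-shift q (p ⊙ x) n)) ⟩
  c * (q ⊙ x) n + (q ⊙ (λ i → (p ⊙ x) (suc i))) n
    ≡⟨ sym (⊙-linear q c x (λ i → (p ⊙ x) (suc i)) n) ⟩
  (q ⊙ (c ∷ p) ⊙ x) n
    ∎
  where open ≡-Reasoning

Annihilates : (ℕ → ℤ) → Poly → Set
Annihilates x R = ∀ n → (R ⊙ x) n ≡ + 0

annihilates-scaleₚ : ∀ {x} c R → Annihilates x R → Annihilates x (scaleₚ c R)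
annihilates-scaleₚ {x} c R ann n = trans (⊙-scaleₚ c R x n) (trans (cong (c *_) (ann n)) (ℤP.*-zeroʳ c))

annihilates-*ₚˡ : ∀ {x} R Q → Annihilates x R → Annihilates x (R *ₚ Q)
annihilates-*ₚˡ {x} R Q ann n =
  trans (⊙-*ₚ R Q x n) (trans (⊙-comm R Q x n) (trans (⊙-congʳ Q ann n) (⊙-zeroʳ Q n)))

monomial : ℕ → ℤ → Poly
monomial zero    t = [ t ]
monomial (suc n) t = + 0 ∷ monomial n t

coeff-*ₚ-monomial-low : ∀ R n t i → i < n → coeff (R *ₚ monomial n t) i ≡ + 0
coeff-*ₚ-monomial-low R (suc n) t zero    _         = *ₚ-shiftʳ R (monomial n t) 0
coeff-*ₚ-monomial-low R (suc n) t (suc i) (s≤s i<n) =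
  trans (*ₚ-shiftʳ R (monomial n t) (suc i)) (coeff-*ₚ-monomial-low R n t i i<n)

coeff-*ₚ-monomial-high : ∀ R n t i → coeff (R *ₚ monomial n t) (i ℕ.+ n) ≡ coeff R i * t
coeff-*ₚ-monomial-high R zero    t i rewrite ℕP.+-identityʳ i = coeff-*ₚ-const R t i
coeff-*ₚ-monomial-high R (suc n) t i rewrite ℕP.+-suc i n =
  trans (*ₚ-shiftʳ R (monomial n t) (suc (i ℕ.+ n))) (coeff-*ₚ-monomial-high R n t i)

coeff-*ₚ-monomial-* : ∀ R n a b i → coeff (R *ₚ monomial n (a * b)) i ≡ a * coeff (R *ₚ monomial n b) i
coeff-*ₚ-monomial-* R n a b i with i ℕP.<? n
... | yes i<n rewrite coeff-*ₚ-monomial-low R n (a * b) i i<n | coeff-*ₚ-monomial-low R n b i i<n =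
  sym (ℤP.*-zeroʳ a)
... | no i≮n = begin
  coeff (R *ₚ monomial n (a * b)) i            ≡⟨ cong (coeff (R *ₚ monomial n (a * b))) (sym i∸n+n≡i) ⟩
  coeff (R *ₚ monomial n (a * b)) (j ℕ.+ n)    ≡⟨ coeff-*ₚ-monomial-high R n (a * b) j ⟩
  coeff R j * (a * b)                          ≡⟨ swap (coeff R j) a b ⟩
  a * (coeff R j * b)                          ≡⟨ cong (a *_) (sym (coeff-*ₚ-monomial-high R n b j)) ⟩
  a * coeff (R *ₚ monomial n b) (j ℕ.+ n)      ≡⟨ cong (λ k → a * coeff (R *ₚ monomial n b) k) i∸n+n≡i ⟩
  a * coeff (R *ₚ monomial n b) i              ∎
  where
  open ≡-Reasoning
  j = i ℕ.∸ n
  i∸n+n≡i : j ℕ.+ n ≡ i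
  i∸n+n≡i = ℕP.m∸n+n≡m (ℕP.≮⇒≥ i≮n)
  swap : ∀ r a b → r * (a * b) ≡ a * (r * b)
  swap = solve-∀

degreeBelow-monomial : ∀ n t → DegreeBelow (suc n) (monomial n t)
degreeBelow-monomial zero    t (suc i) _         = refl
degreeBelow-monomial (suc n) t (suc i) (s≤s n≤i) = degreeBelow-monomial n t i n≤i

degreeBelow-+ₚ : ∀ n p q → DegreeBelow n p → DegreeBelow n q → DegreeBelow n (p +ₚ q)
degreeBelow-+ₚ n p q degp degq i n≤i rewrite coeff-+ₚ p q i | degp i n≤i | degq i n≤i = refl

degreeBelow-weaken : ∀ {m n} p → m ≤ n → DegreeBelow m p → DegreeBelow n p
degreeBelow-weaken p m≤n degp i n≤i = degp i (ℕP.≤-trans m≤n n≤i)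

degreeBelow-length : ∀ A → DegreeBelow (length A) A
degreeBelow-length []      i       _         = refl
degreeBelow-length (a ∷ A) (suc i) (s≤s n≤i) = degreeBelow-length A i n≤i

record PseudoDivision (R : Poly) (d n : ℕ) (A : Poly) : Set where
  field
    quotient remainder : Poly
    identity           : ∀ i → coeff R d ^ n * coeff A i ≡ coeff (R *ₚ quotient) i + coeff remainder i
    remainder-degree   : DegreeBelow d remainder
    quotient-degree    : DegreeBelow n quotient

module _ (R : Poly) (d : ℕ) (degR : DegreeBelow (suc d) R) where

  private
    c = coeff R d

  cancelTop : ℕ → Poly → Poly
  cancelTop n A = scaleₚ c A +ₚ (R *ₚ monomial n (-1ℤ * coeff A (d ℕ.+ n)))

  degreeBelow-cancelTop : ∀ n A → DegreeBelow (d ℕ.+ suc n) A → DegreeBelow (d ℕ.+ n) (cancelTop n A)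
  degreeBelow-cancelTop n A degA i d+n≤i = subst (λ k → coeff (cancelTop n A) k ≡ + 0) j+n≡i (vanishes j d≤j)
    where
    t = coeff A (d ℕ.+ n)
    j = i ℕ.∸ n
    j+n≡i : j ℕ.+ n ≡ i
    j+n≡i = ℕP.m∸n+n≡m (ℕP.≤-trans (ℕP.m≤n+m n d) d+n≤i)
    d≤j : d ≤ j
    d≤j = subst (_≤ j) (ℕP.m+n∸n≡m d n) (ℕP.∸-monoˡ-≤ n d+n≤i)
    coeff-shifted : ∀ k → coeff (cancelTop n A) (k ℕ.+ n) ≡ c * coeff A (k ℕ.+ n) + coeff R k * (-1ℤ * t)
    coeff-shifted k = trans (coeff-+ₚ (scaleₚ c A) _ (k ℕ.+ n))
                            (cong₂ _+_ (coeff-scaleₚ c A (k ℕ.+ n)) (coeff-*ₚ-monomial-high R n _ k))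
    vanishes : ∀ k → d ≤ k → coeff (cancelTop n A) (k ℕ.+ n) ≡ + 0
    vanishes k d≤k with k ℕ.≟ d
    ... | yes refl rewrite coeff-shifted d = cancel c t
      where cancel : ∀ c t → c * t + c * (-1ℤ * t) ≡ + 0
            cancel = solve-∀
    ... | no k≢d with ℕP.≤∧≢⇒< d≤k (λ d≡k → k≢d (sym d≡k))
    ... | d<k
      rewrite coeff-shifted k | degR k d<k
            | degA (k ℕ.+ n) (subst (_≤ k ℕ.+ n) (sym (ℕP.+-suc d n)) (ℕP.+-monoˡ-≤ n d<k))
            | ℤP.*-zeroʳ c | ℤP.*-zeroˡ (-1ℤ * t) = refl

  pseudoDivide : ∀ n A → DegreeBelow (d ℕ.+ n) A → PseudoDivision R d n A
  pseudoDivide zero A degA = record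
    { quotient         = []
    ; remainder        = A
    ; identity         = λ i → trans (ℤP.*-identityˡ _)
                                      (sym (trans (cong (_+ coeff A i) (*ₚ-zeroʳ R i)) (ℤP.+-identityˡ _)))
    ; remainder-degree = λ i d≤i → degA i (subst (_≤ i) (sym (ℕP.+-identityʳ d)) d≤i)
    ; quotient-degree  = λ i _ → refl
    }
  pseudoDivide (suc n) A degA = record
    { quotient         = Q
    ; remainder        = R'
    ; identity         = identity′
    ; remainder-degree = remainder-degree
    ; quotient-degree  = degreeBelow-+ₚ (suc n) Q' _
                           (degreeBelow-weaken Q' (ℕP.n≤1+n n) quotient-degree) (degreeBelow-monomial n _)
    }
    where
    open PseudoDivision (pseudoDivide n (cancelTop n A) (degreeBelow-cancelTop n A degA))
      renaming (quotient to Q'; remainder to R')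
    t : ℤ
    t = coeff A (d ℕ.+ n)
    cⁿ : ℤ
    cⁿ = c ^ n
    Q : Poly
    Q = Q' +ₚ monomial n (cⁿ * t)
    identity′ : ∀ i → c * cⁿ * coeff A i ≡ coeff (R *ₚ Q) i + coeff R' i
    identity′ i = begin
      c * cⁿ * coeff A i                        ≡⟨ expand c cⁿ (coeff A i) u ⟩
      cⁿ * (c * coeff A i + -1ℤ * u) + cⁿ * u   ≡⟨ cong (λ z → cⁿ * z + cⁿ * u) (sym coeff-cancelTop) ⟩
      cⁿ * coeff (cancelTop n A) i + cⁿ * u     ≡⟨ cong (_+ cⁿ * u) (identity i) ⟩
      coeff (R *ₚ Q') i + coeff R' i + cⁿ * u   ≡⟨ swap (coeff (R *ₚ Q') i) (coeff R' i) (cⁿ * u) ⟩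
      coeff (R *ₚ Q') i + cⁿ * u + coeff R' i   ≡⟨ cong (_+ coeff R' i) (sym coeff-RQ) ⟩
      coeff (R *ₚ Q) i + coeff R' i             ∎
      where
      open ≡-Reasoning
      u : ℤ
      u = coeff (R *ₚ monomial n t) i
      coeff-cancelTop : coeff (cancelTop n A) i ≡ c * coeff A i + -1ℤ * u
      coeff-cancelTop = trans (coeff-+ₚ (scaleₚ c A) _ i)
                              (cong₂ _+_ (coeff-scaleₚ c A i) (coeff-*ₚ-monomial-* R n -1ℤ t i))
      coeff-RQ : coeff (R *ₚ Q) i ≡ coeff (R *ₚ Q') i + cⁿ * u
      coeff-RQ = trans (coeff-*ₚ-distribˡ R Q' _ i)
                       (cong (_+_ (coeff (R *ₚ Q') i)) (coeff-*ₚ-monomial-* R n cⁿ t i))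
      expand : ∀ c p a u → c * p * a ≡ p * (c * a + -1ℤ * u) + p * u
      expand = solve-∀
      swap : ∀ x r pu → x + r + pu ≡ x + pu + r
      swap = solve-∀

prime-∣-* : ∀ {p} → Prime p → ∀ a b → + p ∣ a * b → + p ∣ a ⊎ + p ∣ b
prime-∣-* prime-p a b p∣ab =
  Sum.map ∣ᵤ⇒∣ ∣ᵤ⇒∣
    (euclidsLemma ℤ.∣ a ∣ ℤ.∣ b ∣ prime-p (subst (ℕD._∣_ _) (ℤP.abs-* a b) (∣⇒∣ᵤ p∣ab)))

primeDivisor : ∀ k → ∃ λ p → Prime p × p ℕD.∣ suc (suc k)
primeDivisor k with factorise (suc (suc k))
... | record { factors = [] ; isFactorisation = () }
... | record { factors = p ∷ ps ; isFactorisation = k+2≡p*ps ; factorsPrime = prime-p ∷ _ } =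
  p , prime-p , ℕD.divides (ℕL.product ps) (trans k+2≡p*ps (ℕP.*-comm p _))

_∣ᶜ_ : ℕ → Poly → Set
p ∣ᶜ A = ∀ i → + p ∣ coeff A i

∣ᶜ-[] : ∀ p → p ∣ᶜ []
∣ᶜ-[] p i = divides (+ 0) (sym (ℤP.*-zeroˡ (+ p)))

∣ᶜ-∷ : ∀ {p c A} → + p ∣ c → p ∣ᶜ A → p ∣ᶜ (c ∷ A)
∣ᶜ-∷ p∣c p∣A zero    = p∣c
∣ᶜ-∷ p∣c p∣A (suc i) = p∣A i

∣ᶜ-quotient : ∀ p A → p ∣ᶜ A → Σ Poly λ A₂ → ∀ i → coeff A i ≡ coeff A₂ i * + p
∣ᶜ-quotient p []      _   = [] , λ i → sym (ℤP.*-zeroˡ (+ p))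
∣ᶜ-quotient p (a ∷ A) p∣A with ∣ᶜ-quotient p A (λ i → p∣A (suc i))
... | A₂ , A≡A₂p = _∣_.quotient (p∣A 0) ∷ A₂ , λ { zero → _∣_.equality (p∣A 0) ; (suc i) → A≡A₂p i }

-- Gauss's lemma: 𝔽ₚ[x] has no zero divisors.
∣ᶜ-*ₚ : ∀ {p} → Prime p → ∀ R Q → p ∣ᶜ (R *ₚ Q) → p ∣ᶜ R ⊎ p ∣ᶜ Q
∣ᶜ-*ₚ {p} prime-p []      Q       _     = inj₁ (∣ᶜ-[] p)
∣ᶜ-*ₚ {p} prime-p (r ∷ R) []      _     = inj₂ (∣ᶜ-[] p)
∣ᶜ-*ₚ {p} prime-p (r ∷ R) (q ∷ Q) p∣RQ =
  Sum.[ (λ p∣r → Sum.map₁ (∣ᶜ-∷ p∣r) (∣ᶜ-*ₚ prime-p R (q ∷ Q)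
                   (λ j → p∣tail p∣r (coeff-∷*ₚ-suc r R (q ∷ Q) j))))
      , (λ p∣q → Sum.map₂ (∣ᶜ-∷ p∣q) (∣ᶜ-*ₚ prime-p (r ∷ R) Q
                   (λ j → p∣tail p∣q (coeff-*ₚ-∷ʳ (r ∷ R) q Q (suc j)))))
      ] (prime-∣-* prime-p r q (subst (+ p ∣_) (coeff-∷*ₚ-zero r R (q ∷ Q)) (p∣RQ 0)))
  where
  p∣tail : ∀ {a b c j} → + p ∣ a → coeff ((r ∷ R) *ₚ (q ∷ Q)) (suc j) ≡ a * b + c → + p ∣ c
  p∣tail {j = j} p∣a eq = ∣m+n∣m⇒∣n (subst (+ p ∣_) eq (p∣RQ (suc j))) (∣m⇒∣m*n _ p∣a)

leading-*ₚ : ∀ P R Q {d e m} → coeff P (d ℕ.+ e) ≡ + 1 → DegreeBelow (suc d) R → DegreeBelow (suc e) Q →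
             (∀ i → m * coeff P i ≡ coeff (R *ₚ Q) i) → m ≡ coeff R d * coeff Q e
leading-*ₚ P R Q {d} {e} {m} monicP degR degQ mP≡RQ = begin
  m                         ≡⟨ sym (ℤP.*-identityʳ m) ⟩
  m * + 1                   ≡⟨ cong (m *_) (sym monicP) ⟩
  m * coeff P (d ℕ.+ e)     ≡⟨ mP≡RQ (d ℕ.+ e) ⟩
  coeff (R *ₚ Q) (d ℕ.+ e)  ≡⟨ coeff-*ₚ-leading R Q d e degR degQ ⟩
  coeff R d * coeff Q e     ∎
  where open ≡-Reasoning

module _ {p : ℕ} (prime-p : Prime p) where

  private instance
    p≢0 : NonZero p
    p≢0 = prime⇒nonZero prime-p

  1<p : 1 < p
  1<p = ℕ.nonTrivial⇒n>1 p {{prime⇒nonTrivial prime-p}}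

  *p≡0⇒≡0 : ∀ a → a * + p ≡ + 0 → a ≡ + 0
  *p≡0⇒≡0 a ap≡0 with ℤP.i*j≡0⇒i≡0∨j≡0 a ap≡0
  ... | inj₁ a≡0 = a≡0
  ... | inj₂ p≡0 = ⊥-elim (ℕ.≢-nonZero⁻¹ p (cong ℤ.∣_∣ p≡0))

  ∣a∣<∣a*p∣ : ∀ a → a ≢ + 0 → ℤ.∣ a ∣ < ℤ.∣ a * + p ∣
  ∣a∣<∣a*p∣ a a≢0 rewrite ℤP.abs-* a (+ p) =
    ℕP.m<m*n ℤ.∣ a ∣ p {{ℕ.≢-nonZero (λ ∣a∣≡0 → a≢0 (ℤP.∣i∣≡0⇒i≡0 ∣a∣≡0))}} 1<p

  -- As P is monic, m = lead(R) lead(Q) is divisible by p, so by Gauss's lemma p divides R or Q;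
  -- in the second case cancel p from m and Q and repeat, which must stop since |m| decreases.
  prime-∣ᶜ-factor : ∀ P R {d e} → DegreeBelow (suc d) R → + p ∣ coeff R d → coeff P (d ℕ.+ e) ≡ + 1 →
                    ∀ {m} Q → Acc _<_ ℤ.∣ m ∣ → m ≢ + 0 → DegreeBelow (suc e) Q →
                    (∀ i → m * coeff P i ≡ coeff (R *ₚ Q) i) → p ∣ᶜ R
  prime-∣ᶜ-factor P R {d} {e} degR p∣lead monicP {m} Q (acc smaller) m≢0 degQ mP≡RQ =
    Sum.[ (λ p∣R → p∣R) , descend ]
      (∣ᶜ-*ₚ prime-p R Q (λ i → subst (+ p ∣_) (mP≡RQ i) (∣m⇒∣m*n (coeff P i) p∣m)))
    where
    p∣m : + p ∣ m
    p∣m = subst (+ p ∣_) (sym (leading-*ₚ P R Q monicP degR degQ mP≡RQ)) (∣m⇒∣m*n (coeff Q e) p∣lead)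
    descend : p ∣ᶜ Q → p ∣ᶜ R
    descend p∣Q =
      prime-∣ᶜ-factor P R degR p∣lead monicP Q₂ (smaller ∣m₂∣<∣m∣) m₂≢0 degQ₂ m₂P≡RQ₂
      where
      open _∣_ p∣m renaming (quotient to m₂; equality to m≡m₂p)
      Q₂ : Poly
      Q₂ = proj₁ (∣ᶜ-quotient p Q p∣Q)
      Q≡Q₂p : ∀ i → coeff Q i ≡ coeff Q₂ i * + p
      Q≡Q₂p = proj₂ (∣ᶜ-quotient p Q p∣Q)
      m₂≢0 : m₂ ≢ + 0
      m₂≢0 m₂≡0 = m≢0 (trans m≡m₂p (trans (cong (_* + p) m₂≡0) (ℤP.*-zeroˡ (+ p))))
      ∣m₂∣<∣m∣ : ℤ.∣ m₂ ∣ < ℤ.∣ m ∣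
      ∣m₂∣<∣m∣ = subst (λ k → ℤ.∣ m₂ ∣ < ℤ.∣ k ∣) (sym m≡m₂p) (∣a∣<∣a*p∣ m₂ m₂≢0)
      degQ₂ : DegreeBelow (suc e) Q₂
      degQ₂ i e<i = *p≡0⇒≡0 _ (trans (sym (Q≡Q₂p i)) (degQ i e<i))
      Q≈pQ₂ : Q ≈ₚ scaleₚ (+ p) Q₂
      Q≈pQ₂ i = trans (Q≡Q₂p i) (trans (ℤP.*-comm _ (+ p)) (sym (coeff-scaleₚ (+ p) Q₂ i)))
      m₂P≡RQ₂ : ∀ i → m₂ * coeff P i ≡ coeff (R *ₚ Q₂) i
      m₂P≡RQ₂ i = ℤP.*-cancelʳ-≡ _ _ (+ p) (begin
        m₂ * coeff P i * + p             ≡⟨ swap m₂ (coeff P i) (+ p) ⟩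
        m₂ * + p * coeff P i             ≡⟨ cong (_* coeff P i) (sym m≡m₂p) ⟩
        m * coeff P i                    ≡⟨ mP≡RQ i ⟩
        coeff (R *ₚ Q) i                 ≡⟨ *ₚ-congʳ R Q≈pQ₂ i ⟩
        coeff (R *ₚ scaleₚ (+ p) Q₂) i   ≡⟨ coeff-*ₚ-scaleₚʳ R (+ p) Q₂ i ⟩
        + p * coeff (R *ₚ Q₂) i          ≡⟨ ℤP.*-comm (+ p) _ ⟩
        coeff (R *ₚ Q₂) i * + p          ∎)
        where
        open ≡-Reasoning
        swap : ∀ a b c → a * b * c ≡ a * c * b
        swap = solve-∀

record NonzeroAnnihilator (y : ℕ → ℤ) (d : ℕ) (R : Poly) : Set where
  field
    degree      : DegreeBelow (suc d) R
    leading≢0   : coeff R d ≢ + 0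
    annihilates : Annihilates y R

NoAnnihilatorBelow : (ℕ → ℤ) → ℕ → Set
NoAnnihilatorBelow y d = ∀ {d' R} → d' < d → NonzeroAnnihilator y d' R → ⊥

≈[]⊎leading : ∀ d R → DegreeBelow d R →
              R ≈ₚ [] ⊎ ∃ λ d' → d' < d × coeff R d' ≢ + 0 × DegreeBelow (suc d') R
≈[]⊎leading zero    R degR = inj₁ (λ i → degR i z≤n)
≈[]⊎leading (suc d) R degR with coeff R d ℤP.≟ + 0
... | no  lead≢0 = inj₂ (d , ℕP.≤-refl , lead≢0 , degR)
... | yes lead≡0 with ≈[]⊎leading d R degR′
  where
  degR′ : DegreeBelow d R
  degR′ i d≤i with i ℕ.≟ d
  ... | yes refl = lead≡0
  ... | no  i≢d  = degR i (ℕP.≤∧≢⇒< d≤i (λ d≡i → i≢d (sym d≡i)))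
...   | inj₁ R≈[]                         = inj₁ R≈[]
...   | inj₂ (d' , d'<d , lead≢0 , degR″) = inj₂ (d' , ℕP.m<n⇒m<1+n d'<d , lead≢0 , degR″)

annihilator-≈[] : ∀ {y d} R → NoAnnihilatorBelow y d → DegreeBelow d R → Annihilates y R → R ≈ₚ []
annihilator-≈[] {d = d} R none-below degR annR with ≈[]⊎leading d R degR
... | inj₁ R≈[]                         = R≈[]
... | inj₂ (d' , d'<d , lead≢0 , degR′) = ⊥-elim (none-below {R = R} d'<d record
  { degree = degR′ ; leading≢0 = lead≢0 ; annihilates = annR })

annihilates-remainder : ∀ {y} m A R Q R' → Annihilates y A → Annihilates y R →
                        (∀ i → m * coeff A i ≡ coeff (R *ₚ Q) i + coeff R' i) → Annihilates y R'
annihilates-remainder {y} m A R Q R' annA annR mA≡RQ+R' n = begin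
  (R' ⊙ y) n                             ≡⟨ sym (ℤP.+-identityˡ _) ⟩
  + 0 + (R' ⊙ y) n                       ≡⟨ cong (_+ (R' ⊙ y) n) (sym (annihilates-*ₚˡ R Q annR n)) ⟩
  ((R *ₚ Q) ⊙ y) n + (R' ⊙ y) n          ≡⟨ sym (⊙-+ₚ (R *ₚ Q) R' y n) ⟩
  (((R *ₚ Q) +ₚ R') ⊙ y) n               ≡⟨ sym (⊙-congˡ (scaleₚ m A) ((R *ₚ Q) +ₚ R') mA≈RQ+R' y n) ⟩
  (scaleₚ m A ⊙ y) n                     ≡⟨ annihilates-scaleₚ m A annA n ⟩
  + 0                                    ∎
  where
  open ≡-Reasoning
  mA≈RQ+R' : scaleₚ m A ≈ₚ ((R *ₚ Q) +ₚ R')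
  mA≈RQ+R' i = trans (coeff-scaleₚ m A i) (trans (mA≡RQ+R' i) (sym (coeff-+ₚ (R *ₚ Q) R' i)))

divide-annihilator : ∀ {p y d R} → Prime p → NonzeroAnnihilator y d R →
                     (Σ Poly λ R₂ → ∀ i → coeff R i ≡ coeff R₂ i * + p) →
                     Σ Poly λ R₂ → NonzeroAnnihilator y d R₂ × ℤ.∣ coeff R₂ d ∣ < ℤ.∣ coeff R d ∣
divide-annihilator {p} {y} {d} {R} prime-p ann (R₂ , R≡R₂p) = R₂ , ann₂ , ∣lead₂∣<∣lead∣
  where
  open NonzeroAnnihilator ann
  lead₂≢0 : coeff R₂ d ≢ + 0
  lead₂≢0 lead₂≡0 = leading≢0 (trans (R≡R₂p d) (trans (cong (_* + p) lead₂≡0) (ℤP.*-zeroˡ (+ p))))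
  ann₂ : NonzeroAnnihilator y d R₂
  ann₂ = record
    { degree      = λ i d<i → *p≡0⇒≡0 prime-p _ (trans (sym (R≡R₂p i)) (degree i d<i))
    ; leading≢0   = lead₂≢0
    ; annihilates = λ n → *p≡0⇒≡0 prime-p _ (begin
        (R₂ ⊙ y) n * + p           ≡⟨ ℤP.*-comm _ (+ p) ⟩
        + p * (R₂ ⊙ y) n           ≡⟨ sym (⊙-scaleₚ (+ p) R₂ y n) ⟩
        (scaleₚ (+ p) R₂ ⊙ y) n    ≡⟨ ⊙-congˡ (scaleₚ (+ p) R₂) R pR₂≈R y n ⟩
        (R ⊙ y) n                  ≡⟨ annihilates n ⟩
        + 0                        ∎)
    }
    where
    open ≡-Reasoning
    pR₂≈R : scaleₚ (+ p) R₂ ≈ₚ R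
    pR₂≈R i = trans (coeff-scaleₚ (+ p) R₂ i) (trans (ℤP.*-comm (+ p) _) (sym (R≡R₂p i)))
  ∣lead₂∣<∣lead∣ : ℤ.∣ coeff R₂ d ∣ < ℤ.∣ coeff R d ∣
  ∣lead₂∣<∣lead∣ =
    subst (λ c → ℤ.∣ coeff R₂ d ∣ < ℤ.∣ c ∣) (sym (R≡R₂p d)) (∣a∣<∣a*p∣ prime-p _ lead₂≢0)

unit⊎nonunit : ∀ c → c ≢ + 0 → (c ≡ + 1 ⊎ c ≡ -1ℤ) ⊎ ∃ λ k → ℤ.∣ c ∣ ≡ suc (suc k)
unit⊎nonunit (+ zero)        c≢0 = ⊥-elim (c≢0 refl)
unit⊎nonunit (+ suc zero)    _   = inj₁ (inj₁ refl)
unit⊎nonunit (+ suc (suc k)) _   = inj₂ (k , refl)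
unit⊎nonunit -[1+ zero ]     _   = inj₁ (inj₂ refl)
unit⊎nonunit -[1+ suc k ]    _   = inj₂ (k , refl)

module _ {y : ℕ → ℤ} {D : ℕ} {P : Poly}
         (degP : DegreeBelow (suc D) P) (monicP : coeff P D ≡ + 1) (annP : Annihilates y P)
         (minimal : ∀ d R → DegreeBelow (suc d) R → coeff R d ≡ + 1 → Annihilates y R → D ≤ d) where

  -- Pseudo-dividing P by R leaves no remainder, so cⁿ P = R Q and any prime p ∣ c divides R.
  shrink-leading : ∀ {d R} → NoAnnihilatorBelow y d → NonzeroAnnihilator y d R → d < D →
                   ∀ {p} → Prime p → + p ∣ coeff R d →
                   Σ Poly λ R₂ → NonzeroAnnihilator y d R₂ × ℤ.∣ coeff R₂ d ∣ < ℤ.∣ coeff R d ∣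
  shrink-leading {d} {R} none-below ann d<D {p} prime-p p∣lead =
    divide-annihilator prime-p ann (∣ᶜ-quotient p R p∣R)
    where
    open NonzeroAnnihilator ann
    e = D ℕ.∸ d
    d+e≡D : d ℕ.+ e ≡ D
    d+e≡D = ℕP.m+[n∸m]≡n (ℕP.<⇒≤ d<D)
    degP′ : DegreeBelow (d ℕ.+ suc e) P
    degP′ = subst (λ k → DegreeBelow k P) (sym (trans (ℕP.+-suc d e) (cong suc d+e≡D))) degP
    open PseudoDivision (pseudoDivide R d degree (suc e) P degP′)
    exact : ∀ i → coeff R d ^ suc e * coeff P i ≡ coeff (R *ₚ quotient) i
    exact i = trans (identity i) (trans (cong (_+_ (coeff (R *ₚ quotient) i)) (remainder≈[] i)) (ℤP.+-identityʳ _))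
      where
      remainder≈[] : remainder ≈ₚ []
      remainder≈[] = annihilator-≈[] remainder none-below remainder-degree
                     (annihilates-remainder (coeff R d ^ suc e) P R quotient remainder annP annihilates identity)
    p∣R : p ∣ᶜ R
    p∣R = prime-∣ᶜ-factor prime-p P R degree p∣lead (subst (λ k → coeff P k ≡ + 1) (sym d+e≡D) monicP)
            quotient (<-wellFounded _) (λ cⁿ≡0 → leading≢0 (ℤP.i^n≡0⇒i≡0 _ (suc e) cⁿ≡0))
            quotient-degree exact

  -- Opaque, as otherwise checking the recursion in no-annihilator-of-degree unfolds the whole proof.
  opaque
    shrink-nonunit : ∀ {d R} → NoAnnihilatorBelow y d → NonzeroAnnihilator y d R → d < D →
                     ∀ k → ℤ.∣ coeff R d ∣ ≡ suc (suc k) →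
                     Σ Poly λ R₂ → NonzeroAnnihilator y d R₂ × ℤ.∣ coeff R₂ d ∣ < ℤ.∣ coeff R d ∣
    shrink-nonunit none-below ann d<D k ∣lead∣≡k+2 with primeDivisor k
    ... | p , prime-p , p∣k+2 =
      shrink-leading none-below ann d<D prime-p (∣ᵤ⇒∣ (subst (p ℕD.∣_) (sym ∣lead∣≡k+2) p∣k+2))

  unit-leading⇒D≤d : ∀ {d R} → NonzeroAnnihilator y d R → coeff R d ≡ + 1 ⊎ coeff R d ≡ -1ℤ → D ≤ d
  unit-leading⇒D≤d {d} {R} ann (inj₁ lead≡1)  = minimal d R degree lead≡1 annihilates
    where open NonzeroAnnihilator ann
  unit-leading⇒D≤d {d} {R} ann (inj₂ lead≡-1) =
    minimal d (scaleₚ -1ℤ R) deg-R lead-R (annihilates-scaleₚ -1ℤ R annihilates)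
    where
    open NonzeroAnnihilator ann
    deg-R : DegreeBelow (suc d) (scaleₚ -1ℤ R)
    deg-R i d<i = trans (coeff-scaleₚ -1ℤ R i) (cong (-1ℤ *_) (degree i d<i))
    lead-R : coeff (scaleₚ -1ℤ R) d ≡ + 1
    lead-R = trans (coeff-scaleₚ -1ℤ R d) (cong (-1ℤ *_) lead≡-1)

  -- A unit leading coefficient contradicts minimality; otherwise divide out a prime factor of it.
  no-annihilator-of-degree : ∀ {d} → NoAnnihilatorBelow y d → d < D →
                             ∀ {R} → Acc _<_ ℤ.∣ coeff R d ∣ → NonzeroAnnihilator y d R → ⊥
  no-annihilator-of-degree {d} none-below d<D {R} (acc smaller) ann
    with unit⊎nonunit (coeff R d) (NonzeroAnnihilator.leading≢0 ann)
  ... | inj₁ unit = ℕP.<⇒≱ d<D (unit-leading⇒D≤d ann unit)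
  ... | inj₂ (k , ∣lead∣≡k+2) with shrink-nonunit none-below ann d<D k ∣lead∣≡k+2
  ...   | R₂ , ann₂ , ∣lead₂∣<∣lead∣ =
    no-annihilator-of-degree none-below d<D (smaller ∣lead₂∣<∣lead∣) ann₂

  no-annihilator-below : ∀ {d} → Acc _<_ d → d ≤ D → NoAnnihilatorBelow y d
  no-annihilator-below (acc lower) d≤D d'<d =
    no-annihilator-of-degree (no-annihilator-below (lower d'<d) d'≤D) (ℕP.<-≤-trans d'<d d≤D) (<-wellFounded _)
    where d'≤D = ℕP.<⇒≤ (ℕP.<-≤-trans d'<d d≤D)

  -- Pseudo-division by the monic P leaves an annihilator of degree below D, which must vanish.
  minimalAnnihilator-∣ₚ : ∀ T → Annihilates y T → P ∣ₚ T
  minimalAnnihilator-∣ₚ T annT = quotient , λ i → sym (begin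
    coeff T i                                    ≡⟨ sym (ℤP.*-identityˡ _) ⟩
    + 1 * coeff T i                              ≡⟨ cong (_* coeff T i) (sym 1ⁿ≡1) ⟩
    coeff P D ^ length T * coeff T i             ≡⟨ identity i ⟩
    coeff (P *ₚ quotient) i + coeff remainder i  ≡⟨ cong (_+_ (coeff (P *ₚ quotient) i)) (remainder≈[] i) ⟩
    coeff (P *ₚ quotient) i + + 0                ≡⟨ ℤP.+-identityʳ _ ⟩
    coeff (P *ₚ quotient) i                      ∎)
    where
    open ≡-Reasoning
    open PseudoDivision (pseudoDivide P D degP (length T) T
                          (degreeBelow-weaken T (ℕP.m≤n+m _ D) (degreeBelow-length T)))
    1ⁿ≡1 : coeff P D ^ length T ≡ + 1
    1ⁿ≡1 = trans (cong (_^ length T) monicP) (ℤP.^-zeroˡ (length T))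
    remainder≈[] : remainder ≈ₚ []
    remainder≈[] = annihilator-≈[] remainder (no-annihilator-below (<-wellFounded D) ℕP.≤-refl)
                     remainder-degree
                     (annihilates-remainder (coeff P D ^ length T) T P quotient remainder annT annP identity)

sumFin-cong : ∀ {D} {f g : Fin D → ℤ} → (∀ i → f i ≡ g i) → sumFin f ≡ sumFin g
sumFin-cong {zero}  f≡g = refl
sumFin-cong {suc D} f≡g = cong₂ _+_ (f≡g Fin.zero) (sumFin-cong (f≡g ∘ Fin.suc))

sumFin-neg : ∀ {D} (f : Fin D → ℤ) → sumFin (λ i → - f i) ≡ - sumFin f
sumFin-neg {zero}  f = refl
sumFin-neg {suc D} f rewrite sumFin-neg (f ∘ Fin.suc) = sym (ℤP.neg-distrib-+ (f Fin.zero) _)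

coeff-++-high : ∀ L r k → coeff (L ++ r) (k ℕ.+ length L) ≡ coeff r k
coeff-++-high []      r k rewrite ℕP.+-identityʳ k = refl
coeff-++-high (c ∷ L) r k rewrite ℕP.+-suc k (length L) = coeff-++-high L r k

coeff-++-low : ∀ L r j → j < length L → coeff (L ++ r) j ≡ coeff L j
coeff-++-low (c ∷ L) r zero    _         = refl
coeff-++-low (c ∷ L) r (suc j) (s≤s j<n) = coeff-++-low L r j j<n

coeff-tabulate : ∀ d (g : ℕ → ℤ) j → j < d → coeff (tabulate {n = d} (g ∘ toℕ)) j ≡ g j
coeff-tabulate (suc d) g zero    _         = refl
coeff-tabulate (suc d) g (suc j) (s≤s j<d) = coeff-tabulate d (g ∘ suc) j j<d

⊙-∷ʳ : ∀ L c y m → ((L ++ [ c ]) ⊙ y) m ≡ (L ⊙ y) m + c * y (m ℕ.+ length L)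
⊙-∷ʳ []      c y m rewrite ℕP.+-identityʳ m = trans (ℤP.+-identityʳ (c * y m)) (sym (ℤP.+-identityˡ (c * y m)))
⊙-∷ʳ (d ∷ L) c y m rewrite ⊙-∷ʳ L c y (suc m) | ℕP.+-suc m (length L) =
  sym (ℤP.+-assoc (d * y m) ((L ⊙ y) (suc m)) (c * y (suc (m ℕ.+ length L))))

⊙-reverse-tabulate : ∀ D (g : Fin D → ℤ) y m →
                     (reverse (VF.toList g) ⊙ y) m ≡ sumFin (λ i → g i * y (m ℕ.+ (D ℕ.∸ suc (toℕ i))))
⊙-reverse-tabulate zero    g y m = refl
⊙-reverse-tabulate (suc D) g y m
  rewrite ListP.unfold-reverse (g Fin.zero) (VF.toList (g ∘ Fin.suc))
        | ⊙-∷ʳ (reverse (VF.toList (g ∘ Fin.suc))) (g Fin.zero) y m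
        | ListP.length-reverse (VF.toList (g ∘ Fin.suc)) | ListP.length-tabulate (g ∘ Fin.suc)
        | ⊙-reverse-tabulate D (g ∘ Fin.suc) y m
  = ℤP.+-comm (sumFin (λ i → g (Fin.suc i) * y (m ℕ.+ (D ℕ.∸ suc (toℕ i))))) (g Fin.zero * y (m ℕ.+ D))

charPoly-⊙ : ∀ D a y m →
             (charPoly D a ⊙ y) m ≡ y (m ℕ.+ D) - sumFin (λ i → a i * y (m ℕ.+ (D ℕ.∸ suc (toℕ i))))
charPoly-⊙ D a y m
  rewrite ListP.unfold-reverse (+ 1) (VF.toList (λ i → - a i))
        | ⊙-∷ʳ (reverse (VF.toList (λ i → - a i))) (+ 1) y m
        | ListP.length-reverse (VF.toList (λ i → - a i)) | ListP.length-tabulate (λ i → - a i)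
        | ⊙-reverse-tabulate D (λ i → - a i) y m
  = begin
    sumFin (λ i → - a i * y (m ℕ.+ (D ℕ.∸ suc (toℕ i)))) + + 1 * y (m ℕ.+ D)
      ≡⟨ cong₂ _+_ (trans (sumFin-cong (λ i → sym (ℤP.neg-distribˡ-* (a i) _)))
                          (sumFin-neg (λ i → a i * y (m ℕ.+ (D ℕ.∸ suc (toℕ i))))))
                   (ℤP.*-identityˡ (y (m ℕ.+ D))) ⟩
    - sumFin (λ i → a i * y (m ℕ.+ (D ℕ.∸ suc (toℕ i)))) + y (m ℕ.+ D)
      ≡⟨ ℤP.+-comm _ (y (m ℕ.+ D)) ⟩
    y (m ℕ.+ D) - sumFin (λ i → a i * y (m ℕ.+ (D ℕ.∸ suc (toℕ i))))
      ∎
  where open ≡-Reasoning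

∸-suc-shift : ∀ m D k → k < D → suc (m ℕ.+ (D ℕ.∸ suc k)) ≡ suc (m ℕ.+ D) ℕ.∸ suc k
∸-suc-shift m (suc D) zero    _         = sym (ℕP.+-suc m D)
∸-suc-shift m (suc D) (suc k) (s≤s k<D) rewrite ℕP.+-suc m D = ∸-suc-shift m D k k<D

-- x is indexed from 1 while _⊙_ starts at 0, hence the shift x ∘ suc.
charPoly-⊙-suc : ∀ x D a m → (charPoly D a ⊙ (x ∘ suc)) m ≡
                 x (suc (m ℕ.+ D)) - sumFin (λ i → a i * x (suc (m ℕ.+ D) ℕ.∸ suc (toℕ i)))
charPoly-⊙-suc x D a m = trans (charPoly-⊙ D a (x ∘ suc) m)
  (cong (_-_ (x (suc (m ℕ.+ D)))) (sumFin-cong (λ i →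
    cong (λ k → a i * x k) (∸-suc-shift m D (toℕ i) (FinP.toℕ<n i)))))

satisfies⇒annihilates : ∀ x D a → Satisfies x D a → Annihilates (x ∘ suc) (charPoly D a)
satisfies⇒annihilates x D a sat m
  rewrite charPoly-⊙-suc x D a m | sat (suc (m ℕ.+ D)) (s≤s (ℕP.m≤n+m D m)) =
  ℤP.+-inverseʳ (sumFin (λ i → a i * x (suc (m ℕ.+ D) ℕ.∸ suc (toℕ i))))

annihilates⇒satisfies : ∀ x D a → Annihilates (x ∘ suc) (charPoly D a) → Satisfies x D a
annihilates⇒satisfies x D a ann n D<n =
  subst (λ n → x n ≡ sumFin (λ i → a i * x (n ℕ.∸ suc (toℕ i)))) m+D+1≡n
        (ℤP.i-j≡0⇒i≡j _ _ (trans (sym (charPoly-⊙-suc x D a m)) (ann m)))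
  where
  m = n ℕ.∸ suc D
  m+D+1≡n : suc (m ℕ.+ D) ≡ n
  m+D+1≡n = trans (sym (ℕP.+-suc m D)) (ℕP.m∸n+n≡m D<n)

charPoly-∷ʳ : ∀ D a → charPoly D a ≡ reverse (VF.toList (λ i → - a i)) ++ [ + 1 ]
charPoly-∷ʳ D a = ListP.unfold-reverse (+ 1) (VF.toList (λ i → - a i))

length-reverse-toList : ∀ {D} (g : Fin D → ℤ) → length (reverse (VF.toList g)) ≡ D
length-reverse-toList g = trans (ListP.length-reverse (VF.toList g)) (ListP.length-tabulate g)

coeff-++-above : ∀ L c i → length L < i → coeff (L ++ [ c ]) i ≡ + 0
coeff-++-above L c i L<i = subst (λ k → coeff (L ++ [ c ]) k ≡ + 0) (ℕP.m∸n+n≡m (ℕP.<⇒≤ L<i))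
  (trans (coeff-++-high L [ c ] (i ℕ.∸ length L)) (beyond (i ℕ.∸ length L) (ℕP.m<n⇒0<n∸m L<i)))
  where
  beyond : ∀ k → 0 < k → coeff [ c ] k ≡ + 0
  beyond (suc k) _ = refl

charPoly-degree : ∀ D a → DegreeBelow (suc D) (charPoly D a)
charPoly-degree D a i D<i rewrite charPoly-∷ʳ D a =
  coeff-++-above (reverse (VF.toList (λ i → - a i))) (+ 1) i
    (subst (_< i) (sym (length-reverse-toList (λ i → - a i))) D<i)

charPoly-monic : ∀ D a → coeff (charPoly D a) D ≡ + 1
charPoly-monic D a rewrite charPoly-∷ʳ D a =
  subst (λ k → coeff (reverse (VF.toList (λ i → - a i)) ++ [ + 1 ]) k ≡ + 1) (length-reverse-toList (λ i → - a i))
        (coeff-++-high (reverse (VF.toList (λ i → - a i))) [ + 1 ] 0)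

tabulate-lookup-subst : ∀ {d} (L : List ℤ) (e : length L ≡ d) →
                        tabulate (subst (λ n → Fin n → ℤ) e (lookup L)) ≡ L
tabulate-lookup-subst L refl = ListP.tabulate-lookup L

-- The recurrence is read off the low coefficients R₀, …, R_{d-1} of R, in reverse order.
monic-annihilator⇒recurrence : ∀ x d R → DegreeBelow (suc d) R → coeff R d ≡ + 1 →
                               Annihilates (x ∘ suc) R → Σ (Fin d → ℤ) (Satisfies x d)
monic-annihilator⇒recurrence x d R degR monicR annR =
  a , annihilates⇒satisfies x d a (λ m → trans (⊙-congˡ (charPoly d a) R charPoly≈R (x ∘ suc) m) (annR m))
  where
  low = VF.toList (λ (i : Fin d) → coeff R (toℕ i))
  length-low : length low ≡ d
  length-low = ListP.length-tabulate (λ i → coeff R (toℕ i))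
  length-reverse-low : length (reverse low) ≡ d
  length-reverse-low = length-reverse-toList (λ i → coeff R (toℕ i))
  lookup-reverse-low : Fin d → ℤ
  lookup-reverse-low = subst (λ n → Fin n → ℤ) length-reverse-low (lookup (reverse low))
  a : Fin d → ℤ
  a i = - lookup-reverse-low i
  charPoly≡ : charPoly d a ≡ low ++ [ + 1 ]
  charPoly≡ = begin
    reverse (+ 1 ∷ VF.toList (λ i → - a i))
      ≡⟨ cong (λ l → reverse (+ 1 ∷ l))
              (trans (ListP.tabulate-cong {f = λ i → - a i} (ℤP.neg-involutive ∘ lookup-reverse-low))
                     (tabulate-lookup-subst (reverse low) length-reverse-low)) ⟩
    reverse (+ 1 ∷ reverse low)
      ≡⟨ ListP.unfold-reverse (+ 1) (reverse low) ⟩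
    reverse (reverse low) ++ [ + 1 ]
      ≡⟨ cong (_++ [ + 1 ]) (ListP.reverse-involutive low) ⟩
    low ++ [ + 1 ]
      ∎
    where open ≡-Reasoning
  low+1≈R : (low ++ [ + 1 ]) ≈ₚ R
  low+1≈R j with j ℕP.<? d
  ... | yes j<d = trans (coeff-++-low low _ j (subst (j <_) (sym length-low) j<d)) (coeff-tabulate d (coeff R) j j<d)
  ... | no  j≮d = subst (λ k → coeff (low ++ [ + 1 ]) k ≡ coeff R k) k+d≡j
                        (trans (coeff-++-high low [ + 1 ] k) (high k))
    where
    k = j ℕ.∸ d
    k+d≡j : k ℕ.+ length low ≡ j
    k+d≡j rewrite length-low = ℕP.m∸n+n≡m (ℕP.≮⇒≥ j≮d)
    high : ∀ k → coeff [ + 1 ] k ≡ coeff R (k ℕ.+ length low)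
    high zero    rewrite length-low = sym monicR
    high (suc k) rewrite length-low = sym (degR (suc k ℕ.+ d) (s≤s (ℕP.m≤n+m d k)))
  charPoly≈R : charPoly d a ≈ₚ R
  charPoly≈R j = trans (cong (λ P → coeff P j) charPoly≡) (low+1≈R j)

sumTo-cong : ∀ n {f g} → (∀ j → f j ≡ g j) → sumTo n f ≡ sumTo n g
sumTo-cong zero    f≡g = f≡g 0
sumTo-cong (suc n) f≡g = cong₂ _+_ (sumTo-cong n f≡g) (f≡g (suc n))

sumTo-linear : ∀ n c f g → sumTo n (λ j → c * f j + g j) ≡ c * sumTo n f + sumTo n g
sumTo-linear zero    c f g = refl
sumTo-linear (suc n) c f g rewrite sumTo-linear n c f g =
  regroup c (sumTo n f) (sumTo n g) (f (suc n)) (g (suc n))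
  where regroup : ∀ c a b u v → c * a + b + (c * u + v) ≡ c * (a + u) + (b + v)
        regroup = solve-∀

sumTo-+ : ∀ n f g → sumTo n (λ j → f j + g j) ≡ sumTo n f + sumTo n g
sumTo-+ n f g = trans (sumTo-cong n (λ j → cong (_+ g j) (sym (ℤP.*-identityˡ (f j)))))
                      (trans (sumTo-linear n (+ 1) f g) (cong (_+ sumTo n g) (ℤP.*-identityˡ (sumTo n f))))

sumTo-zero : ∀ n {g} → (∀ j → g j ≡ + 0) → sumTo n g ≡ + 0
sumTo-zero zero    g≡0 = g≡0 0
sumTo-zero (suc n) g≡0 rewrite sumTo-zero n g≡0 | g≡0 (suc n) = refl

sumTo-unfoldˡ : ∀ n f → sumTo (suc n) f ≡ f 0 + sumTo n (f ∘ suc)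
sumTo-unfoldˡ zero    f = refl
sumTo-unfoldˡ (suc n) f rewrite sumTo-unfoldˡ n f = ℤP.+-assoc (f 0) _ _

binomialTransform : (ℕ → ℤ) → ℕ → ℤ
binomialTransform f n = sumTo n (λ j → f j * + (n C j))

binomialTransform-cong : ∀ {f g} → (∀ j → f j ≡ g j) → ∀ n → binomialTransform f n ≡ binomialTransform g n
binomialTransform-cong f≡g n = sumTo-cong n (λ j → cong (_* + (n C j)) (f≡g j))

binomialTransform-linear : ∀ c f g n →
  binomialTransform (λ j → c * f j + g j) n ≡ c * binomialTransform f n + binomialTransform g n
binomialTransform-linear c f g n =
  trans (sumTo-cong n (λ j → trans (ℤP.*-distribʳ-+ (+ (n C j)) (c * f j) (g j))
                                   (cong (_+ g j * + (n C j)) (ℤP.*-assoc c (f j) _))))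
        (sumTo-linear n c (λ j → f j * + (n C j)) (λ j → g j * + (n C j)))

binomialTransform-zero : ∀ n → binomialTransform (λ _ → + 0) n ≡ + 0
binomialTransform-zero n = sumTo-zero n (λ j → ℤP.*-zeroˡ (+ (n C j)))

binomialTransform-suc : ∀ f n → binomialTransform f (suc n) ≡ binomialTransform f n + binomialTransform (f ∘ suc) n
binomialTransform-suc f n = begin
  binomialTransform f (suc n)
    ≡⟨ sumTo-unfoldˡ n (λ j → f j * + (suc n C j)) ⟩
  f 0 * + 1 + sumTo n (λ j → f (suc j) * + (suc n C suc j))
    ≡⟨ cong (_+_ (f 0 * + 1)) (trans (sumTo-cong n pascal) (sumTo-+ n _ _)) ⟩
  f 0 * + 1 + (binomialTransform (f ∘ suc) n + U)
    ≡⟨ swap (f 0 * + 1) (binomialTransform (f ∘ suc) n) U ⟩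
  (f 0 * + 1 + U) + binomialTransform (f ∘ suc) n
    ≡⟨ cong (_+ binomialTransform (f ∘ suc) n) unshift ⟩
  binomialTransform f n + binomialTransform (f ∘ suc) n
    ∎
  where
  open ≡-Reasoning
  U = sumTo n (λ j → f (suc j) * + (n C suc j))
  pascal : ∀ j → f (suc j) * + (suc n C suc j) ≡ f (suc j) * + (n C j) + f (suc j) * + (n C suc j)
  pascal j = trans (cong (λ k → f (suc j) * + k) (sym (nCk+nC[k+1]≡[n+1]C[k+1] n j)))
                   (trans (cong (f (suc j) *_) (ℤP.pos-+ (n C j) (n C suc j))) (ℤP.*-distribˡ-+ (f (suc j)) _ _))
  swap : ∀ a b u → a + (b + u) ≡ a + u + b
  swap = solve-∀
  unshift : f 0 * + 1 + U ≡ binomialTransform f n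
  unshift = begin
    f 0 * + 1 + U
      ≡⟨ sym (sumTo-unfoldˡ n (λ j → f j * + (n C j))) ⟩
    binomialTransform f n + f (suc n) * + (n C suc n)
      ≡⟨ cong (λ k → binomialTransform f n + f (suc n) * + k) (k>n⇒nCk≡0 (ℕP.n<1+n n)) ⟩
    binomialTransform f n + f (suc n) * + 0
      ≡⟨ cong (_+_ (binomialTransform f n)) (ℤP.*-zeroʳ (f (suc n))) ⟩
    binomialTransform f n + + 0
      ≡⟨ ℤP.+-identityʳ _ ⟩
    binomialTransform f n
      ∎

binomialTransform-alternating : ∀ g → (∀ j → g (suc j) ≡ - g j) → ∀ n → binomialTransform g (suc n) ≡ + 0
binomialTransform-alternating g alt n = begin
  binomialTransform g (suc n)                            ≡⟨ binomialTransform-suc g n ⟩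
  binomialTransform g n + binomialTransform (g ∘ suc) n  ≡⟨ cong (_+_ (binomialTransform g n)) negated ⟩
  binomialTransform g n + -1ℤ * binomialTransform g n    ≡⟨ cancel (binomialTransform g n) ⟩
  + 0                                                    ∎
  where
  open ≡-Reasoning
  negate : ∀ j → g (suc j) ≡ -1ℤ * g j + + 0
  negate j = trans (alt j) (sym (trans (ℤP.+-identityʳ _) (ℤP.-1*i≡-i (g j))))
  negated : binomialTransform (g ∘ suc) n ≡ -1ℤ * binomialTransform g n
  negated = begin
    binomialTransform (g ∘ suc) n
      ≡⟨ binomialTransform-cong negate n ⟩
    binomialTransform (λ j → -1ℤ * g j + + 0) n
      ≡⟨ binomialTransform-linear -1ℤ g (λ _ → + 0) n ⟩
    -1ℤ * binomialTransform g n + binomialTransform (λ _ → + 0) n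
      ≡⟨ cong (_+_ (-1ℤ * binomialTransform g n)) (binomialTransform-zero n) ⟩
    -1ℤ * binomialTransform g n + + 0
      ≡⟨ ℤP.+-identityʳ _ ⟩
    -1ℤ * binomialTransform g n
      ∎
  cancel : ∀ a → a + -1ℤ * a ≡ + 0
  cancel = solve-∀

Intertwines : Poly → Poly → Set
Intertwines A A' = ∀ f n → (A ⊙ binomialTransform f) n ≡ binomialTransform (A' ⊙ f) n

intertwines-respʳ : ∀ A A' A'' → Intertwines A A' → (∀ f j → (A' ⊙ f) j ≡ (A'' ⊙ f) j) → Intertwines A A''
intertwines-respʳ A A' A'' int A'≗A'' f n = trans (int f n) (binomialTransform-cong (A'≗A'' f) n)

intertwines-const : ∀ c → Intertwines [ c ] [ c ]
intertwines-const c f n =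
  sym (trans (binomialTransform-linear c f (λ _ → + 0) n)
             (cong (_+_ (c * binomialTransform f n)) (binomialTransform-zero n)))

intertwines-+ₚ : ∀ A A' B B' → Intertwines A A' → Intertwines B B' → Intertwines (A +ₚ B) (A' +ₚ B')
intertwines-+ₚ A A' B B' intA intB f n = begin
  ((A +ₚ B) ⊙ binomialTransform f) n
    ≡⟨ ⊙-+ₚ A B (binomialTransform f) n ⟩
  (A ⊙ binomialTransform f) n + (B ⊙ binomialTransform f) n
    ≡⟨ cong₂ _+_ (intA f n) (intB f n) ⟩
  binomialTransform (A' ⊙ f) n + binomialTransform (B' ⊙ f) n
    ≡⟨ cong (_+ binomialTransform (B' ⊙ f) n) (sym (ℤP.*-identityˡ (binomialTransform (A' ⊙ f) n))) ⟩
  + 1 * binomialTransform (A' ⊙ f) n + binomialTransform (B' ⊙ f) n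
    ≡⟨ sym (binomialTransform-linear (+ 1) (A' ⊙ f) (B' ⊙ f) n) ⟩
  binomialTransform (λ j → + 1 * (A' ⊙ f) j + (B' ⊙ f) j) n
    ≡⟨ binomialTransform-cong (λ j → trans (cong (_+ (B' ⊙ f) j) (ℤP.*-identityˡ ((A' ⊙ f) j)))
                                           (sym (⊙-+ₚ A' B' f j))) n ⟩
  binomialTransform ((A' +ₚ B') ⊙ f) n
    ∎
  where open ≡-Reasoning

intertwines-*ₚ : ∀ A A' B B' → Intertwines A A' → Intertwines B B' → Intertwines (A *ₚ B) (A' *ₚ B')
intertwines-*ₚ A A' B B' intA intB f n = begin
  ((A *ₚ B) ⊙ binomialTransform f) n      ≡⟨ ⊙-*ₚ A B (binomialTransform f) n ⟩
  (A ⊙ B ⊙ binomialTransform f) n         ≡⟨ ⊙-congʳ A (intB f) n ⟩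
  (A ⊙ binomialTransform (B' ⊙ f)) n      ≡⟨ intA (B' ⊙ f) n ⟩
  binomialTransform (A' ⊙ B' ⊙ f) n       ≡⟨ binomialTransform-cong (λ j → sym (⊙-*ₚ A' B' f j)) n ⟩
  binomialTransform ((A' *ₚ B') ⊙ f) n    ∎
  where open ≡-Reasoning

-- Pascal's rule: the shift acts on binomial transforms as x + 1.
intertwines-X : Intertwines X (X +ₚ [ + 1 ])
intertwines-X f n = begin
  + 0 * binomialTransform f n + (+ 1 * binomialTransform f (suc n) + + 0)
    ≡⟨ cong (λ z → + 0 * binomialTransform f n + (+ 1 * z + + 0)) (binomialTransform-suc f n) ⟩
  + 0 * binomialTransform f n + (+ 1 * (binomialTransform f n + binomialTransform (f ∘ suc) n) + + 0)
    ≡⟨ regroup (binomialTransform f n) (binomialTransform (f ∘ suc) n) ⟩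
  + 1 * binomialTransform f n + (+ 1 * binomialTransform (f ∘ suc) n + + 0)
    ≡⟨ cong (λ z → + 1 * binomialTransform f n + (+ 1 * binomialTransform (f ∘ suc) n + z))
            (sym (binomialTransform-zero n)) ⟩
  + 1 * binomialTransform f n + (+ 1 * binomialTransform (f ∘ suc) n + binomialTransform (λ _ → + 0) n)
    ≡⟨ cong (_+_ (+ 1 * binomialTransform f n)) (sym (binomialTransform-linear (+ 1) (f ∘ suc) (λ _ → + 0) n)) ⟩
  + 1 * binomialTransform f n + binomialTransform (λ j → + 1 * f (suc j) + + 0) n
    ≡⟨ sym (binomialTransform-linear (+ 1) f (λ j → + 1 * f (suc j) + + 0) n) ⟩
  binomialTransform (λ j → + 1 * f j + (+ 1 * f (suc j) + + 0)) n
    ∎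
  where
  open ≡-Reasoning
  regroup : ∀ a b → + 0 * a + (+ 1 * (a + b) + + 0) ≡ + 1 * a + (+ 1 * b + + 0)
  regroup = solve-∀

-- Adding [ −1 ] on both sides: X +ₚ [ + 1 ] +ₚ [ −1 ] computes to X, and X +ₚ [ −1 ] to X − 1.
intertwines-X-1 : Intertwines (X- (+ 1)) X
intertwines-X-1 = intertwines-+ₚ X (X +ₚ [ + 1 ]) [ -1ℤ ] [ -1ℤ ] intertwines-X (intertwines-const -1ℤ)

intertwines-X-2 : Intertwines (X- (+ 2)) (X- (+ 1))
intertwines-X-2 = intertwines-+ₚ (X- (+ 1)) X [ -1ℤ ] [ -1ℤ ] intertwines-X-1 (intertwines-const -1ℤ)

intertwines-composeₚ : ∀ q → Intertwines (composeₚ q (X- (+ 1))) q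
intertwines-composeₚ []      f n = sym (binomialTransform-zero n)
intertwines-composeₚ (c ∷ q) = intertwines-respʳ (composeₚ (c ∷ q) (X- (+ 1))) ([ c ] +ₚ (X *ₚ q)) (c ∷ q)
  (intertwines-+ₚ [ c ] [ c ] ((X- (+ 1)) *ₚ composeₚ q (X- (+ 1))) (X *ₚ q) (intertwines-const c)
    (intertwines-*ₚ (X- (+ 1)) X (composeₚ q (X- (+ 1))) q intertwines-X-1 (intertwines-composeₚ q)))
  (λ f j → begin
    (([ c ] +ₚ (X *ₚ q)) ⊙ f) j
      ≡⟨ ⊙-+ₚ [ c ] (X *ₚ q) f j ⟩
    c * f j + + 0 + ((X *ₚ q) ⊙ f) j
      ≡⟨ cong (_+_ (c * f j + + 0)) (⊙-*ₚ X q f j) ⟩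
    c * f j + + 0 + (+ 0 * (q ⊙ f) j + (+ 1 * (q ⊙ f) (suc j) + + 0))
      ≡⟨ simplify (c * f j) ((q ⊙ f) j) ((q ⊙ f) (suc j)) ⟩
    c * f j + (q ⊙ f) (suc j)
      ∎)
  where
  open ≡-Reasoning
  simplify : ∀ a u v → a + + 0 + (+ 0 * u + (+ 1 * v + + 0)) ≡ a + v
  simplify = solve-∀

-- bitProd m L before the substitution x ↦ x − 1
bitProdΦ : ℕ → ℕ → Poly
bitProdΦ m zero    = [ + 1 ]
bitProdΦ m (suc L) = (if bitSet m (suc L) then Φ2^suc (suc L) else [ + 1 ]) *ₚ bitProdΦ m L

intertwines-bitProd : ∀ m L → Intertwines (bitProd m L) (bitProdΦ m L)
intertwines-bitProd m zero = intertwines-const (+ 1)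
intertwines-bitProd m (suc L) with bitSet m (suc L)
... | true  = intertwines-*ₚ (composeₚ (Φ2^suc (suc L)) (X- (+ 1))) (Φ2^suc (suc L)) (bitProd m L) (bitProdΦ m L)
                (intertwines-composeₚ (Φ2^suc (suc L))) (intertwines-bitProd m L)
... | false = intertwines-*ₚ [ + 1 ] [ + 1 ] (bitProd m L) (bitProdΦ m L) (intertwines-const (+ 1)) (intertwines-bitProd m L)

isOdd : ℕ → Bool
isOdd zero    = false
isOdd (suc n) = not (isOdd n)

odd?≡isOdd : ∀ m → odd? m ≡ isOdd m
odd?≡isOdd zero          = refl
odd?≡isOdd (suc zero)    = refl
odd?≡isOdd (suc (suc m)) = trans (odd?≡isOdd m) (sym (BoolP.not-involutive (isOdd m)))

/2≡⌊/2⌋ : ∀ m → m / 2 ≡ ⌊ m /2⌋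
/2≡⌊/2⌋ zero          = refl
/2≡⌊/2⌋ (suc zero)    = refl
/2≡⌊/2⌋ (suc (suc m)) = trans (m/n≡1+[m∸n]/n {suc (suc m)} {2} (s≤s (s≤s z≤n))) (cong suc (/2≡⌊/2⌋ m))

bit : ℕ → ℕ → Bool
bit m zero    = isOdd m
bit m (suc b) = bit ⌊ m /2⌋ b

bitSet≡bit : ∀ m b → bitSet m b ≡ bit m b
bitSet≡bit m zero    = odd?≡isOdd m
bitSet≡bit m (suc b) = trans (bitSet≡bit (m / 2) b) (cong (λ n → bit n b) (/2≡⌊/2⌋ m))

isOdd-+ : ∀ a b → isOdd (a ℕ.+ b) ≡ isOdd a xor isOdd b
isOdd-+ zero    b = refl
isOdd-+ (suc a) b rewrite isOdd-+ a b = BoolP.not-distribˡ-xor (isOdd a) (isOdd b)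

isOdd-2* : ∀ k → isOdd (2 ℕ.* k) ≡ false
isOdd-2* k rewrite ℕP.+-identityʳ k | isOdd-+ k k = BoolP.xor-same (isOdd k)

⌊2*k+j/2⌋ : ∀ k j → ⌊ 2 ℕ.* k ℕ.+ j /2⌋ ≡ k ℕ.+ ⌊ j /2⌋
⌊2*k+j/2⌋ zero    j = refl
⌊2*k+j/2⌋ (suc k) j = trans (cong (λ n → ⌊ n ℕ.+ j /2⌋) (ℕP.*-suc 2 k)) (cong suc (⌊2*k+j/2⌋ k j))

bit-zero : ∀ b → bit 0 b ≡ false
bit-zero zero    = refl
bit-zero (suc b) = bit-zero b

bit-flip-below : ∀ b c j → c < b → bit (2 ℕ.^ b ℕ.+ j) c ≡ bit j c
bit-flip-below (suc b) zero    j _ rewrite isOdd-+ (2 ℕ.* 2 ℕ.^ b) j | isOdd-2* (2 ℕ.^ b) = refl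
bit-flip-below (suc b) (suc c) j (s≤s c<b) rewrite ⌊2*k+j/2⌋ (2 ℕ.^ b) j = bit-flip-below b c ⌊ j /2⌋ c<b

bit-flip : ∀ b j → bit (2 ℕ.^ b ℕ.+ j) b ≡ not (bit j b)
bit-flip zero    j = refl
bit-flip (suc b) j rewrite ⌊2*k+j/2⌋ (2 ℕ.^ b) j = bit-flip b ⌊ j /2⌋

bit⇒< : ∀ m b → bit m b ≡ true → b < m
bit⇒< zero    b       bit≡1 rewrite bit-zero b with bit≡1
... | ()
bit⇒< (suc m) zero    _     = s≤s z≤n
bit⇒< (suc m) (suc b) bit≡1 = ℕP.≤-<-trans (bit⇒< ⌊ suc m /2⌋ b bit≡1) (ℕP.⌊n/2⌋<n m)

bit-borF : ∀ f m n → m ≤ f → n ≤ f → ∀ b → bit (borF f m n) b ≡ bit m b ∨ bit n b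
bit-borF zero    zero zero z≤n z≤n b rewrite bit-zero b = refl
bit-borF (suc f) m    n    m≤f n≤f b = digits (odd? m ∨ odd? n) refl b
  where
  rest = borF f (m / 2) (n / 2)
  /2≤ : ∀ k → k ≤ suc f → k / 2 ≤ f
  /2≤ zero    _         = z≤n
  /2≤ (suc k) (s≤s k≤f) rewrite /2≡⌊/2⌋ (suc k) = ℕP.≤-trans (ℕP.≤-pred (ℕP.⌊n/2⌋<n k)) k≤f
  bit-rest : ∀ b → bit rest b ≡ bit ⌊ m /2⌋ b ∨ bit ⌊ n /2⌋ b
  bit-rest b rewrite sym (/2≡⌊/2⌋ m) | sym (/2≡⌊/2⌋ n) =
    bit-borF f (m / 2) (n / 2) (/2≤ m m≤f) (/2≤ n n≤f) b
  digits : ∀ c → c ≡ (odd? m ∨ odd? n) →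
           ∀ b → bit ((if c then 1 else 0) ℕ.+ 2 ℕ.* rest) b ≡ bit m b ∨ bit n b
  digits true  c≡ zero    rewrite isOdd-2* rest | odd?≡isOdd m | odd?≡isOdd n = c≡
  digits false c≡ zero    rewrite isOdd-2* rest | odd?≡isOdd m | odd?≡isOdd n = c≡
  digits true  _  (suc b) = trans (cong (λ k → bit k b) (trans (cong ⌊_/2⌋ (ℕP.+-comm 1 (2 ℕ.* rest)))
                                  (trans (⌊2*k+j/2⌋ rest 1) (ℕP.+-identityʳ rest)))) (bit-rest b)
  digits false _  (suc b) = trans (cong (λ k → bit k b) (trans (cong ⌊_/2⌋ (sym (ℕP.+-identityʳ (2 ℕ.* rest))))
                                  (trans (⌊2*k+j/2⌋ rest 0) (ℕP.+-identityʳ rest)))) (bit-rest b)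

bit-∨ᵇ : ∀ m n b → bit (m ∨ᵇ n) b ≡ bit m b ∨ bit n b
bit-∨ᵇ m n = bit-borF (m ℕ.+ n) m n (ℕP.m≤m+n m n) (ℕP.m≤n+m n m)

-- Pascal's recursion, which unlike _C_ computes by pattern matching.
binom : ℕ → ℕ → ℕ
binom n       zero    = 1
binom zero    (suc k) = 0
binom (suc n) (suc k) = binom n k ℕ.+ binom n (suc k)

binom≡C : ∀ n k → binom n k ≡ n C k
binom≡C n       zero    = refl
binom≡C zero    (suc k) = sym (k>n⇒nCk≡0 {0} {suc k} (s≤s z≤n))
binom≡C (suc n) (suc k) rewrite binom≡C n k | binom≡C n (suc k) = nCk+nC[k+1]≡[n+1]C[k+1] n k

oddBinom : ℕ → ℕ → Bool
oddBinom n k = isOdd (binom n k)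

double : ℕ → ℕ
double zero    = zero
double (suc a) = suc (suc (double a))

xor-cancel-middle : ∀ a b c → (a xor b) xor (b xor c) ≡ a xor c
xor-cancel-middle true  true  c = refl
xor-cancel-middle true  false c = refl
xor-cancel-middle false true  c = BoolP.not-involutive c
xor-cancel-middle false false c = refl

oddBinom-suc-suc : ∀ n k → oddBinom (suc (suc n)) (suc (suc k)) ≡ oddBinom n k xor oddBinom n (suc (suc k))
oddBinom-suc-suc n k
  rewrite isOdd-+ (binom (suc n) (suc k)) (binom (suc n) (suc (suc k)))
        | isOdd-+ (binom n k) (binom n (suc k)) | isOdd-+ (binom n (suc k)) (binom n (suc (suc k)))
  = xor-cancel-middle (oddBinom n k) (oddBinom n (suc k)) (oddBinom n (suc (suc k)))

oddBinom-even-even : ∀ a c → oddBinom (double a) (double c) ≡ oddBinom a c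
oddBinom-even-odd  : ∀ a c → oddBinom (double a) (suc (double c)) ≡ false
oddBinom-even-even a       zero    = refl
oddBinom-even-even zero    (suc c) = refl
oddBinom-even-even (suc a) (suc c)
  rewrite oddBinom-suc-suc (double a) (double c) | oddBinom-even-even a c | oddBinom-even-even a (suc c)
  = sym (isOdd-+ (binom a c) (binom a (suc c)))
oddBinom-even-odd zero    c       = refl
oddBinom-even-odd (suc a) zero
  rewrite isOdd-+ (binom (suc (double a)) 0) (binom (suc (double a)) 1)
        | isOdd-+ (binom (double a) 0) (binom (double a) 1) | oddBinom-even-odd a 0 = refl
oddBinom-even-odd (suc a) (suc c)
  rewrite oddBinom-suc-suc (double a) (suc (double c)) | oddBinom-even-odd a c | oddBinom-even-odd a (suc c) = refl

oddBinom-odd-even : ∀ a c → oddBinom (suc (double a)) (double c) ≡ oddBinom a c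
oddBinom-odd-even a zero    = refl
oddBinom-odd-even a (suc c)
  rewrite isOdd-+ (binom (double a) (suc (double c))) (binom (double a) (suc (suc (double c))))
        | oddBinom-even-odd a c | oddBinom-even-even a (suc c) = refl

oddBinom-odd-odd : ∀ a c → oddBinom (suc (double a)) (suc (double c)) ≡ oddBinom a c
oddBinom-odd-odd a c
  rewrite isOdd-+ (binom (double a) (double c)) (binom (double a) (suc (double c)))
        | oddBinom-even-even a c | oddBinom-even-odd a c = BoolP.xor-identityʳ (oddBinom a c)

isOdd-double : ∀ a → isOdd (double a) ≡ false
isOdd-double zero    = refl
isOdd-double (suc a) rewrite isOdd-double a = refl

⌊double/2⌋ : ∀ a → ⌊ double a /2⌋ ≡ a
⌊double/2⌋ zero    = refl
⌊double/2⌋ (suc a) = cong suc (⌊double/2⌋ a)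

⌊suc-double/2⌋ : ∀ a → ⌊ suc (double a) /2⌋ ≡ a
⌊suc-double/2⌋ zero    = refl
⌊suc-double/2⌋ (suc a) = cong suc (⌊suc-double/2⌋ a)

even⊎odd : ∀ j → ∃ λ a → j ≡ double a ⊎ j ≡ suc (double a)
even⊎odd zero    = 0 , inj₁ refl
even⊎odd (suc zero) = 0 , inj₂ refl
even⊎odd (suc (suc j)) with even⊎odd j
... | a , inj₁ j≡2a   = suc a , inj₁ (cong (suc ∘′ suc) j≡2a)
... | a , inj₂ j≡2a+1 = suc a , inj₂ (cong (suc ∘′ suc) j≡2a+1)

-- Lucas's theorem modulo 2, one binary digit at a time.
lucas : ∀ j k → oddBinom j k ≡ (not (isOdd k) ∨ isOdd j) ∧ oddBinom ⌊ j /2⌋ ⌊ k /2⌋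
lucas j k with even⊎odd j | even⊎odd k
... | a , inj₁ refl | c , inj₁ refl rewrite isOdd-double c | ⌊double/2⌋ a | ⌊double/2⌋ c = oddBinom-even-even a c
... | a , inj₁ refl | c , inj₂ refl rewrite isOdd-double c | isOdd-double a = oddBinom-even-odd a c
... | a , inj₂ refl | c , inj₁ refl rewrite isOdd-double c | ⌊suc-double/2⌋ a | ⌊double/2⌋ c = oddBinom-odd-even a c
... | a , inj₂ refl | c , inj₂ refl rewrite isOdd-double c | isOdd-double a | ⌊suc-double/2⌋ a | ⌊suc-double/2⌋ c =
  oddBinom-odd-odd a c

oddBinom-bits : ∀ k → Acc _<_ k → ∀ j j' → (∀ b → bit k b ≡ true → bit j b ≡ bit j' b) →
                oddBinom j k ≡ oddBinom j' k
oddBinom-bits zero    _          j j' _       = refl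
oddBinom-bits (suc k) (acc less) j j' j≈j' rewrite lucas j (suc k) | lucas j' (suc k) =
  cong₂ _∧_ lowest
    (oddBinom-bits ⌊ suc k /2⌋ (less (ℕP.⌊n/2⌋<n k)) ⌊ j /2⌋ ⌊ j' /2⌋ (λ b → j≈j' (suc b)))
  where
  lowest : not (isOdd (suc k)) ∨ isOdd j ≡ not (isOdd (suc k)) ∨ isOdd j'
  lowest with isOdd (suc k) in k-odd
  ... | true  = j≈j' 0 k-odd
  ... | false = refl

⊙-x²-1 : ∀ G j → (X- -1ℤ ⊙ X- (+ 1) ⊙ G) j ≡ G (suc (suc j)) - G j
⊙-x²-1 G j = expand (G j) (G (suc j)) (G (suc (suc j)))
  where expand : ∀ a b c → + 1 * (-1ℤ * a + (+ 1 * b + + 0)) + (+ 1 * (-1ℤ * b + (+ 1 * c + + 0)) + + 0) ≡ c - a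
        expand = solve-∀

⊙-Xpow : ∀ N F i → (Xpow N ⊙ F) i ≡ F (N ℕ.+ i)
⊙-Xpow zero    F i = trans (ℤP.+-identityʳ _) (ℤP.*-identityˡ _)
⊙-Xpow (suc N) F i rewrite ⊙-Xpow N F (suc i) | ℕP.+-suc N i = ℤP.+-identityˡ _

⊙-Φ2^suc : ∀ b F i → (Φ2^suc b ⊙ F) i ≡ F (2 ℕ.^ b ℕ.+ i) + F i
⊙-Φ2^suc b F i = trans (⊙-+ₚ (Xpow (2 ℕ.^ b)) [ + 1 ] F i)
  (cong₂ _+_ (⊙-Xpow (2 ℕ.^ b) F i) (trans (ℤP.+-identityʳ _) (ℤP.*-identityˡ (F i))))

≡⊎≡not : ∀ x y → x ≡ y ⊎ x ≡ not y
≡⊎≡not true  true  = inj₁ refl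
≡⊎≡not true  false = inj₂ refl
≡⊎≡not false true  = inj₂ refl
≡⊎≡not false false = inj₁ refl

module _ (K : ℕ) where

  Relevant : ℕ → ℕ → Set
  Relevant L b = b ≡ 0 ⊎ ∃ λ b' → b ≡ suc b' × b' < L × bitSet K (suc b') ≡ true

  AgreeOn : ℕ → ℕ → ℕ → Set
  AgreeOn L j j' = ∀ b → Relevant L b → bit j b ≡ bit j' b

  DependsOn : ℕ → (ℕ → ℤ) → Set
  DependsOn L F = ∀ j j' → AgreeOn L j j' → F j ≡ F j'

  relevant⇒≤ : ∀ {L b} → Relevant L b → b < suc L
  relevant⇒≤ (inj₁ refl)                = s≤s z≤n
  relevant⇒≤ (inj₂ (_ , refl , b'<L , _)) = s≤s b'<L

  agreeOn-suc : ∀ {L j j'} → AgreeOn L j j' → bit j (suc L) ≡ bit j' (suc L) → AgreeOn (suc L) j j'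
  agreeOn-suc j≈j' top c (inj₁ c≡0) = j≈j' c (inj₁ c≡0)
  agreeOn-suc {L} j≈j' top c (inj₂ (c' , refl , c'<L+1 , set)) with c' ℕ.≟ L
  ... | yes refl = top
  ... | no  c'≢L = j≈j' (suc c') (inj₂ (c' , refl , ℕP.≤∧≢⇒< (ℕP.≤-pred c'<L+1) c'≢L , set))

  agreeOn-flipˡ : ∀ {L j j'} → AgreeOn L j j' → AgreeOn L (2 ℕ.^ suc L ℕ.+ j) j'
  agreeOn-flipˡ {L} {j} j≈j' c rel = trans (bit-flip-below (suc L) c j (relevant⇒≤ rel)) (j≈j' c rel)

  agreeOn-flipʳ : ∀ {L j j'} → AgreeOn L j j' → AgreeOn L j (2 ℕ.^ suc L ℕ.+ j')
  agreeOn-flipʳ {L} {j} {j'} j≈j' c rel = trans (j≈j' c rel) (sym (bit-flip-below (suc L) c j' (relevant⇒≤ rel)))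

  -- F(2^(L+1) + j) + F(j) is symmetric in bit L+1 of j, so it no longer depends on that bit.
  dependsOn-Φ : ∀ L F → DependsOn (suc L) F → DependsOn L (λ i → F (2 ℕ.^ suc L ℕ.+ i) + F i)
  dependsOn-Φ L F dep j j' j≈j' with ≡⊎≡not (bit j (suc L)) (bit j' (suc L))
  ... | inj₁ same = cong₂ _+_
    (dep _ _ (agreeOn-suc (agreeOn-flipʳ (agreeOn-flipˡ j≈j'))
      (trans (bit-flip (suc L) j) (trans (cong not same) (sym (bit-flip (suc L) j'))))))
    (dep _ _ (agreeOn-suc j≈j' same))
  ... | inj₂ opposite = trans (cong₂ _+_
    (dep _ _ (agreeOn-suc (agreeOn-flipˡ j≈j')
      (trans (bit-flip (suc L) j) (trans (cong not opposite) (BoolP.not-involutive _)))))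
    (dep _ _ (agreeOn-suc (agreeOn-flipʳ j≈j') (trans opposite (sym (bit-flip (suc L) j'))))))
    (ℤP.+-comm (F j') (F (2 ℕ.^ suc L ℕ.+ j')))

  dependsOn-unset : ∀ L F → bitSet K (suc L) ≡ false → DependsOn (suc L) F → DependsOn L F
  dependsOn-unset L F unset dep j j' j≈j' = dep j j' λ
    { c (inj₁ c≡0)                          → j≈j' c (inj₁ c≡0)
    ; c (inj₂ (c' , c≡ , c'<L+1 , set)) → j≈j' c (inj₂ (c' , c≡ , below c' c'<L+1 set , set)) }
    where
    below : ∀ c' → c' < suc L → bitSet K (suc c') ≡ true → c' < L
    below c' c'<L+1 set with c' ℕ.≟ L
    ... | yes refl = ⊥-elim (BoolP.not-¬ set unset)
    ... | no  c'≢L = ℕP.≤∧≢⇒< (ℕP.≤-pred c'<L+1) c'≢L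

  -- Each relevant bit b ≥ 1 is removed by the factor Φ_{2^{b+1}}; what remains depends on bit 0 only,
  -- hence has period 2 and is annihilated by x² − 1.
  annihilates-bitProdΦ : ∀ L F → DependsOn L F → ∀ j → (X- -1ℤ ⊙ X- (+ 1) ⊙ bitProdΦ K L ⊙ F) j ≡ + 0
  annihilates-bitProdΦ zero F dep j = begin
    (X- -1ℤ ⊙ X- (+ 1) ⊙ [ + 1 ] ⊙ F) j              ≡⟨ ⊙-x²-1 ([ + 1 ] ⊙ F) j ⟩
    + 1 * F (suc (suc j)) + + 0 - (+ 1 * F j + + 0)  ≡⟨ cong (λ z → + 1 * z + + 0 - (+ 1 * F j + + 0)) period-2 ⟩
    + 1 * F j + + 0 - (+ 1 * F j + + 0)              ≡⟨ ℤP.+-inverseʳ (+ 1 * F j + + 0) ⟩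
    + 0                                              ∎
    where
    open ≡-Reasoning
    period-2 : F (suc (suc j)) ≡ F j
    period-2 = dep (suc (suc j)) j λ
      { .0 (inj₁ refl)              → BoolP.not-involutive (isOdd j)
      ; b  (inj₂ (_ , _ , () , _)) }
  annihilates-bitProdΦ (suc L) F dep j = begin
    (X- -1ℤ ⊙ X- (+ 1) ⊙ bitProdΦ K (suc L) ⊙ F) j
      ≡⟨ ⊙-congʳ (X- -1ℤ) (⊙-congʳ (X- (+ 1)) factor-first) j ⟩
    (X- -1ℤ ⊙ X- (+ 1) ⊙ bitProdΦ K L ⊙ Φ ⊙ F) j
      ≡⟨ annihilates-bitProdΦ L (Φ ⊙ F) (dependsOn-factor (bitSet K (suc L)) refl) j ⟩
    + 0
      ∎
    where
    open ≡-Reasoning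
    Φ = if bitSet K (suc L) then Φ2^suc (suc L) else [ + 1 ]
    factor-first : ∀ i → (bitProdΦ K (suc L) ⊙ F) i ≡ (bitProdΦ K L ⊙ Φ ⊙ F) i
    factor-first i = trans (⊙-*ₚ Φ (bitProdΦ K L) F i) (⊙-comm Φ (bitProdΦ K L) F i)
    dependsOn-factor : ∀ s → bitSet K (suc L) ≡ s → DependsOn L ((if s then Φ2^suc (suc L) else [ + 1 ]) ⊙ F)
    dependsOn-factor true  _     j j' j≈j' = trans (⊙-Φ2^suc (suc L) F j)
      (trans (dependsOn-Φ L F dep j j' j≈j') (sym (⊙-Φ2^suc (suc L) F j')))
    dependsOn-factor false unset j j' j≈j' = cong (λ z → + 1 * z + + 0) (dependsOn-unset L F unset dep j j' j≈j')

binomialSum : ℕ → List ℕ → ℕ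
binomialSum j = foldr (λ k acc → (j C k) ℕ.+ acc) 0

signSequence : List ℕ → ℕ → ℤ
signSequence ks j = neg1^ (binomialSum j ks)

neg1^≡ : ∀ e → neg1^ e ≡ (if isOdd e then -1ℤ else + 1)
neg1^≡ zero    = refl
neg1^≡ (suc e) rewrite neg1^≡ e with isOdd e
... | true  = refl
... | false = refl

bit-bigOr : ∀ ks {k} b → k ∈ ks → bit k b ≡ true → bit (bigOr ks) b ≡ true
bit-bigOr (k' ∷ ks) b k∈ks set rewrite bit-∨ᵇ k' (bigOr ks) b with k∈ks
... | here refl    rewrite set = refl
... | there k∈ks′ rewrite bit-bigOr ks b k∈ks′ set = BoolP.∨-zeroʳ (bit k' b)

bit-kbar : ∀ ks b → bit (bigOr ks) (suc b) ≡ true → bit (kbar ks) (suc b) ≡ true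
bit-kbar ks b set =
  trans (cong (λ m → bit m b) ⌊kbar/2⌋) (trans (cong (λ m → bit m b) (/2≡⌊/2⌋ (bigOr ks))) set)
  where
  ⌊kbar/2⌋ : ℕ.⌊ kbar ks /2⌋ ≡ bigOr ks / 2
  ⌊kbar/2⌋ = trans (⌊2*k+j/2⌋ (bigOr ks / 2) 1) (ℕP.+-identityʳ _)

relevant-kbar : ∀ ks {k} b → k ∈ ks → bit k b ≡ true → Relevant (kbar ks) (kbar ks) b
relevant-kbar ks zero    _    _   = inj₁ refl
relevant-kbar ks (suc b) k∈ks set = inj₂ (b , refl , ℕP.<-trans (ℕP.n<1+n b) (bit⇒< (kbar ks) (suc b) set′) ,
                                           trans (bitSet≡bit (kbar ks) (suc b)) set′)
  where set′ = bit-kbar ks b (bit-bigOr ks (suc b) k∈ks set)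

isOdd-binomialSum : ∀ j j' ks → (∀ {k} → k ∈ ks → oddBinom j k ≡ oddBinom j' k) →
                    isOdd (binomialSum j ks) ≡ isOdd (binomialSum j' ks)
isOdd-binomialSum j j' []       _ = refl
isOdd-binomialSum j j' (k ∷ ks) same
  rewrite isOdd-+ (j C k) (binomialSum j ks) | isOdd-+ (j' C k) (binomialSum j' ks)
        | sym (binom≡C j k) | sym (binom≡C j' k)
  = cong₂ _xor_ (same (here refl)) (isOdd-binomialSum j j' ks (same ∘ there))

-- By Lucas's theorem the sign at j only sees the bits of j set in some kᵢ, all of which are set in k̄.
signSequence-dependsOn : ∀ ks → DependsOn (kbar ks) (kbar ks) (signSequence ks)
signSequence-dependsOn ks j j' j≈j'
  rewrite neg1^≡ (binomialSum j ks) | neg1^≡ (binomialSum j' ks)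
        | isOdd-binomialSum j j' ks (λ {k} k∈ks → oddBinom-bits k (<-wellFounded k) j j'
                                       (λ b set → j≈j' b (relevant-kbar ks b k∈ks set)))
  = refl

annihilates-targetPoly : ∀ ks → Annihilates (S ks ∘ suc) (targetPoly ks)
annihilates-targetPoly ks m = begin
  (targetPoly ks ⊙ (S ks ∘ suc)) m
    ≡⟨ ⊙-shift (targetPoly ks) (S ks) m ⟩
  (targetPoly ks ⊙ S ks) (suc m)
    ≡⟨⟩
  (targetPoly ks ⊙ binomialTransform (signSequence ks)) (suc m)
    ≡⟨ intertwines-*ₚ (X- (+ 2)) (X- (+ 1)) (bitProd K K) (bitProdΦ K K)
         intertwines-X-2 (intertwines-bitProd K K) (signSequence ks) (suc m) ⟩
  binomialTransform g (suc m)
    ≡⟨ binomialTransform-alternating g alternating m ⟩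
  + 0
    ∎
  where
  open ≡-Reasoning
  K = kbar ks
  g : ℕ → ℤ
  g = ((X- (+ 1)) *ₚ bitProdΦ K K) ⊙ signSequence ks
  alternating : ∀ j → g (suc j) ≡ - g j
  alternating j = begin
    g (suc j)                                    ≡⟨ isolate (g j) (g (suc j)) ⟩
    (+ 1 * g j + (+ 1 * g (suc j) + + 0)) - g j  ≡⟨ cong (_- g j) x+1-annihilates ⟩
    + 0 - g j                                    ≡⟨ ℤP.+-identityˡ (- g j) ⟩
    - g j                                        ∎
    where
    isolate : ∀ a b → b ≡ (+ 1 * a + (+ 1 * b + + 0)) - a
    isolate = solve-∀
    x+1-annihilates : (X- -1ℤ ⊙ g) j ≡ + 0
    x+1-annihilates = trans (⊙-congʳ (X- -1ℤ) (⊙-*ₚ (X- (+ 1)) (bitProdΦ K K) (signSequence ks)) j)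
                            (annihilates-bitProdΦ K K (signSequence ks) (signSequence-dependsOn ks) j)

mainTheorem4 : (k : ℕ) (ks : List ℕ) → 1 ≤ k → Linked _<_ (k ∷ ks) →
    (D : ℕ) (a : Fin D → ℤ) → IsMinimalRecurrence (S (k ∷ ks)) D a →
    charPoly D a ∣ₚ targetPoly (k ∷ ks)
mainTheorem4 k ks _ _ D a (satisfies , minimal) =
  minimalAnnihilator-∣ₚ {x ∘ suc} {D} {charPoly D a}
    (charPoly-degree D a) (charPoly-monic D a) (satisfies⇒annihilates x D a satisfies)
    (λ d R degR monicR annR → let a′ , satisfies′ = monic-annihilator⇒recurrence x d R degR monicR annR
                               in minimal d a′ satisfies′)
    (targetPoly (k ∷ ks)) (annihilates-targetPoly (k ∷ ks))
  where
  x = S (k ∷ ks)
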